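{- In $GP(n,2)$, for the inner vertex $v_0$ and $V=\{v_0,\dots,v_{n-1}\}$, $$B(v_0,V)=\begin{cases}\frac1{16}(n^2-6n+21) & n\in\{13,17,21,\ldots\},\\ \frac{n^3-5n^2+3n+137}{16(n+1)} & n\in\{15,19,23,\ldots\},\\ \frac1{16}(n-2)(n-4) & n\text{ even},\ n\ge 12.\end{cases}$$
   Context: For an integer $n\ge 5$, $GP(n,2)$ is the graph with vertex set $\{u_0,\dots,u_{n-1},v_0,\dots,v_{n-1}\}$ and edges $u_iu_{i+1}$, $u_iv_i$, $v_iv_{i+2}$ ($0\le i\le n-1$, subscripts modulo $n$). For vertices $s,t,x$ of a graph $G$, $\sigma_{st}$ is the number of shortest $s$–$t$ paths and $\sigma_{st}(x)$ the number of those passing through $x$. For $S\subseteq V(G)$, the betweenness centrality of $x$ induced by $S$ is $B(x,S)=\sum \sigma_{st}(x)/\sigma_{st}$, summed over unordered pairs $\{s,t\}$ of distinct vertices of $S\setminus\{x\}$. -}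

module Defs where

open import Data.Bool using (Bool; true; false; if_then_else_)
open import Data.Nat as ℕ using (ℕ; zero; suc; _+_; _∸_; NonZero)
open import Data.Nat.DivMod using (_%_; m%n<n)
open import Data.Fin as Fin using (Fin; toℕ; fromℕ<)
import Data.Fin.Properties as FinP
open import Data.Integer using (+_)
open import Data.Rational as ℚ using (ℚ; 0ℚ)
open import Data.List using (List; []; _∷_; map; concatMap; filter; length; foldr; _++_; last)
open import Data.List.Membership.DecPropositional using ()
open import Data.Maybe using (Maybe; just; nothing)
open import Data.Product using (_×_; _,_)
open import Relation.Nullary using (Dec; yes; no; ¬_)
open import Relation.Nullary.Decidable using (⌊_⌋; does)
open import Relation.Binary.PropositionalEquality using (_≡_; refl; cong)
import Data.List.Relation.Unary.Any as Any

-- The generalized Petersen graph GP(n,2).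
-- Vertex u i is the outer vertex u_i, vertex v i is the inner vertex v_i.

data Vertex (n : ℕ) : Set where
  u : Fin n → Vertex n
  v : Fin n → Vertex n

_≟V_ : ∀ {n} → (x y : Vertex n) → Dec (x ≡ y)
u i ≟V u j with i Fin.≟ j
... | yes refl = yes refl
... | no i≢j = no (λ { refl → i≢j refl })
u i ≟V v j = no (λ ())
v i ≟V u j = no (λ ())
v i ≟V v j with i Fin.≟ j
... | yes refl = yes refl
... | no i≢j = no (λ { refl → i≢j refl })

shift : (n : ℕ) .{{_ : NonZero n}} → ℕ → Fin n → Fin n
shift n k i = fromℕ< (m%n<n (toℕ i + k) n)

nbrs : (n : ℕ) .{{_ : NonZero n}} → Vertex n → List (Vertex n)
nbrs n (u i) = u (shift n 1 i) ∷ u (shift n (n ∸ 1) i) ∷ v i ∷ []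
nbrs n (v i) = v (shift n 2 i) ∷ v (shift n (n ∸ 2) i) ∷ u i ∷ []

walks : (n : ℕ) .{{_ : NonZero n}} → ℕ → Vertex n → List (List (Vertex n))
walks n zero    s = (s ∷ []) ∷ []
walks n (suc k) s = concatMap (λ w → map (s ∷_) (walks n k w)) (nbrs n s)

endsAt : ∀ {n} → Vertex n → List (Vertex n) → Bool
endsAt t p with last p
... | just x  = does (x ≟V t)
... | nothing = false

walksTo : (n : ℕ) .{{_ : NonZero n}} → ℕ → Vertex n → Vertex n → List (List (Vertex n))
walksTo n k s t = filter (λ p → endsAt t p Data.Bool.≟ true) (walks n k s)
  where import Data.Bool

-- Shortest s–t paths: the s–t walks of minimal length k (such walks are paths).
-- The search tries k = start, start+1, ... with the given fuel; the graph has
-- 2n vertices, so the distance is < 2n and fuel 2n suffices.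
searchGeo : (n : ℕ) .{{_ : NonZero n}} → ℕ → ℕ → Vertex n → Vertex n → List (List (Vertex n))
searchGeo n zero       k s t = []
searchGeo n (suc fuel) k s t with walksTo n k s t
... | []      = searchGeo n fuel (suc k) s t
... | (p ∷ ps) = p ∷ ps

geodesics : (n : ℕ) .{{_ : NonZero n}} → Vertex n → Vertex n → List (List (Vertex n))
geodesics n s t = searchGeo n (n + n) 0 s t

_∈?_ : ∀ {n} → (x : Vertex n) → (p : List (Vertex n)) → Dec (Any.Any (x ≡_) p)
x ∈? p = Any.any? (x ≟V_) p

σ : (n : ℕ) .{{_ : NonZero n}} → Vertex n → Vertex n → ℕ
σ n s t = length (geodesics n s t)

σvia : (n : ℕ) .{{_ : NonZero n}} → Vertex n → Vertex n → Vertex n → ℕ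
σvia n s t x = length (filter (x ∈?_) (geodesics n s t))

-- a / b as a rational (b = 0 never occurs for connected graphs; it is set to 0)
frac : ℕ → ℕ → ℚ
frac a zero    = 0ℚ
frac a (suc b) = (+ a) ℚ./ suc b

-- unordered pairs {s,t} of distinct elements of a duplicate-free list
pairs : ∀ {A : Set} → List A → List (A × A)
pairs []       = []
pairs (a ∷ as) = map (a ,_) as ++ pairs as

sumℚ : List ℚ → ℚ
sumℚ = foldr ℚ._+_ 0ℚ

-- The set S is given as a duplicate-free list of vertices.
-- B(x,S) = Σ over unordered pairs {s,t} ⊆ S∖{x}, s ≠ t, of σ_st(x)/σ_st
B : (n : ℕ) .{{_ : NonZero n}} → Vertex n → List (Vertex n) → ℚ
B n x S = sumℚ (map (λ { (s , t) → frac (σvia n s t x) (σ n s t) })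
                    (pairs (filter (λ y → Relation.Nullary.¬? (y ≟V x)) S)))

inner : (n : ℕ) → List (Vertex n)
inner n = map v (Data.List.allFin n)
  where import Data.List

v₀ : (n : ℕ) .{{_ : NonZero n}} → Vertex n
v₀ n = v (fromℕ< (m%n<n 0 n))

-- Shortest paths are the walks of minimal length, and these are certified by a potential:
-- if E vanishes exactly at v₀, changes by at most one along edges, and N satisfies
-- N s = Σ { N y | y ~ s, E y + 1 = E s } with N v₀ = 1, then E s = d(s, v₀) and N s = σ(s, v₀).
-- For n ≥ 12 such E and N are explicit: the distance from v_k is the shorter of the two arcs
-- k and n − k around the inner cycle.  Rotating a pair {v_a, v_b} (a < b) by r = n − b shows that
-- it contributes the fraction of v_{a+r}–v₀ geodesics through v_r; grouping pairs by s = a + r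
-- turns B(v₀, V) into Σ_{2 ≤ s < n} ρ s, where ρ s is ⌊(s − 1)/2⌋ when the arc s is strictly
-- shorter than n − s, 0 when it is strictly longer, and a weighted share on a tie.  Outside a
-- window of five or six values of s around n/2 the comparison is decided by the size of s alone;
-- evaluating the window in each residue class of n modulo 4 gives the three formulas.

module Submission where

module Betweenness where

  open import Algebra.Structures using (IsCommutativeMonoid)
  import Data.Bool.Properties as Bool
  open import Data.Bool as Bool using (Bool; true; false; if_then_else_; _∧_; _∨_)
  open import Data.Empty using (⊥-elim)
  open import Data.Fin as Fin using (Fin; toℕ)
  open import Data.Fin.Properties using (toℕ-fromℕ<; toℕ-injective; toℕ<n)
  open import Data.Integer as ℤ using (ℤ)
  import Data.Integer.Properties as ℤP
  import Data.Integer.Tactic.RingSolver as ℤSolver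
  open import Data.List using (List; []; _∷_; map; concatMap; filter; length; _++_; tabulate)
  open import Data.List.Properties using (map-∘; map-cong; filter-all)
  open import Data.List.Relation.Binary.Pointwise using (Pointwise; []; _∷_)
  open import Data.List.Relation.Unary.All as All using (All; []; _∷_)
  import Data.List.Relation.Unary.All.Properties as AllP
  open import Data.Nat as ℕ using (ℕ; zero; suc; _+_; _∸_; _*_; _⊓_; ⌊_/2⌋; _≤_; _<_; _≟_; _≤?_; _<?_; z≤n; s≤s; NonZero)
  open import Data.Nat.DivMod using (_%_; _/_; m≡m%n+[m/n]*n; %-distribˡ-+; m%n%n≡m%n; [m+n]%n≡m%n; m<n⇒m%n≡m; n%n≡0)
  open import Data.Nat.Properties
  open import Data.Nat.Tactic.RingSolver using (solve-∀)
  open import Data.Product using (∃; _×_; _,_; proj₁; proj₂)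
  open import Data.Rational as ℚ using (ℚ; 0ℚ)
  import Data.Rational.Properties as ℚP
  import Data.Rational.Unnormalised as ℚᵘ
  import Data.Rational.Unnormalised.Properties as ℚᵘP
  open import Data.Sum using (_⊎_; inj₁; inj₂)
  open import Function using (_∘_)
  open import Relation.Binary.Definitions using (tri<; tri≈; tri>)
  open import Relation.Binary.PropositionalEquality
  open import Relation.Nullary using (Dec; yes; no; ¬_; ¬?)
  open import Relation.Nullary.Decidable using (does; True; toWitness)

  open import Defs

  -- Finite sums and counting

  interval : ℕ → ℕ → List ℕ
  interval lo zero    = []
  interval lo (suc k) = lo ∷ interval (suc lo) k

  interval-++ : ∀ lo a b → interval lo (a + b) ≡ interval lo a ++ interval (lo + a) b
  interval-++ lo zero    b = cong (λ z → interval z b) (sym (+-identityʳ lo))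
  interval-++ lo (suc a) b =
    cong (lo ∷_) (trans (interval-++ (suc lo) a b) (cong (λ z → interval (suc lo) a ++ interval z b) (sym (+-suc lo a))))

  interval-snoc : ∀ lo k → interval lo (suc k) ≡ interval lo k ++ (lo + k ∷ [])
  interval-snoc lo k = trans (cong (interval lo) (+-comm 1 k)) (interval-++ lo k 1)

  module Summation {A : Set} {_⊕_ : A → A → A} {ε : A}
                   (isCM : IsCommutativeMonoid _≡_ _⊕_ ε) where

    open IsCommutativeMonoid isCM using (assoc; comm; identityˡ; identityʳ)

    ∑ : {B : Set} → List B → (B → A) → A
    ∑ xs h = Data.List.foldr _⊕_ ε (map h xs)

    ∑-++ : {B : Set} (xs ys : List B) (h : B → A) → ∑ (xs ++ ys) h ≡ ∑ xs h ⊕ ∑ ys h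
    ∑-++ []       ys h = sym (identityˡ (∑ ys h))
    ∑-++ (x ∷ xs) ys h = trans (cong (h x ⊕_) (∑-++ xs ys h)) (sym (assoc (h x) (∑ xs h) (∑ ys h)))

    ∑-congᴬ : {B : Set} {xs : List B} {h k : B → A} → All (λ x → h x ≡ k x) xs → ∑ xs h ≡ ∑ xs k
    ∑-congᴬ []         = refl
    ∑-congᴬ (e ∷ es) = cong₂ _⊕_ e (∑-congᴬ es)

    ∑-cong : {B : Set} (xs : List B) {h k : B → A} → (∀ x → h x ≡ k x) → ∑ xs h ≡ ∑ xs k
    ∑-cong xs e = cong (Data.List.foldr _⊕_ ε) (map-cong e xs)

    ∑-map : {B C : Set} (f : B → C) (xs : List B) (h : C → A) → ∑ (map f xs) h ≡ ∑ xs (h ∘ f)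
    ∑-map f xs h = cong (Data.List.foldr _⊕_ ε) (sym (map-∘ xs))

    ∑-ε : {B : Set} (xs : List B) → ∑ xs (λ _ → ε) ≡ ε
    ∑-ε []       = refl
    ∑-ε (x ∷ xs) = trans (cong (ε ⊕_) (∑-ε xs)) (identityˡ ε)

    ∑-⊕ : {B : Set} (xs : List B) (h k : B → A) → ∑ xs (λ x → h x ⊕ k x) ≡ ∑ xs h ⊕ ∑ xs k
    ∑-⊕ []       h k = sym (identityˡ ε)
    ∑-⊕ (x ∷ xs) h k = trans (cong ((h x ⊕ k x) ⊕_) (∑-⊕ xs h k)) (interchange (h x) (k x) (∑ xs h) (∑ xs k))
      where
      interchange : ∀ a b c d → (a ⊕ b) ⊕ (c ⊕ d) ≡ (a ⊕ c) ⊕ (b ⊕ d)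
      interchange a b c d = begin
        (a ⊕ b) ⊕ (c ⊕ d)  ≡⟨ assoc a b (c ⊕ d) ⟩
        a ⊕ (b ⊕ (c ⊕ d))  ≡⟨ cong (a ⊕_) (sym (assoc b c d)) ⟩
        a ⊕ ((b ⊕ c) ⊕ d)  ≡⟨ cong (λ z → a ⊕ (z ⊕ d)) (comm b c) ⟩
        a ⊕ ((c ⊕ b) ⊕ d)  ≡⟨ cong (a ⊕_) (assoc c b d) ⟩
        a ⊕ (c ⊕ (b ⊕ d))  ≡⟨ sym (assoc a c (b ⊕ d)) ⟩
        (a ⊕ c) ⊕ (b ⊕ d)  ∎
        where open ≡-Reasoning

    ∑-congᴵ : ∀ lo k {h h′ : ℕ → A} → (∀ x → lo ≤ x → x < lo + k → h x ≡ h′ x)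
            → ∑ (interval lo k) h ≡ ∑ (interval lo k) h′
    ∑-congᴵ lo zero    e = refl
    ∑-congᴵ lo (suc k) e = cong₂ _⊕_
      (e lo ≤-refl (subst (lo <_) (sym (+-suc lo k)) (s≤s (m≤m+n lo k))))
      (∑-congᴵ (suc lo) k (λ x l u → e x (≤-trans (n≤1+n lo) l) (subst (x <_) (sym (+-suc lo k)) u)))

    ∑-snoc : ∀ lo k (h : ℕ → A) → ∑ (interval lo (suc k)) h ≡ ∑ (interval lo k) h ⊕ h (lo + k)
    ∑-snoc lo k h = begin
      ∑ (interval lo (suc k)) h                      ≡⟨ cong (λ L → ∑ L h) (interval-snoc lo k) ⟩
      ∑ (interval lo k ++ (lo + k ∷ [])) h           ≡⟨ ∑-++ (interval lo k) (lo + k ∷ []) h ⟩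
      ∑ (interval lo k) h ⊕ (h (lo + k) ⊕ ε)         ≡⟨ cong (∑ (interval lo k) h ⊕_) (identityʳ (h (lo + k))) ⟩
      ∑ (interval lo k) h ⊕ h (lo + k)               ∎
      where open ≡-Reasoning

    ∑-reverse : ∀ c lo (h : ℕ → A) → ∑ (interval lo c) (λ b → h (lo + c ∸ b)) ≡ ∑ (interval 1 c) h
    ∑-reverse zero    lo h = refl
    ∑-reverse (suc c) lo h = begin
      h (lo + suc c ∸ lo) ⊕ ∑ (interval (suc lo) c) (λ b → h (lo + suc c ∸ b))
        ≡⟨ cong₂ _⊕_ (cong h (m+n∸m≡n lo (suc c)))
                     (∑-cong (interval (suc lo) c) (λ b → cong (λ z → h (z ∸ b)) (+-suc lo c))) ⟩
      h (suc c) ⊕ ∑ (interval (suc lo) c) (λ b → h (suc lo + c ∸ b))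
        ≡⟨ cong (h (suc c) ⊕_) (∑-reverse c (suc lo) h) ⟩
      h (suc c) ⊕ ∑ (interval 1 c) h
        ≡⟨ comm (h (suc c)) (∑ (interval 1 c) h) ⟩
      ∑ (interval 1 c) h ⊕ h (1 + c)
        ≡⟨ sym (∑-snoc 1 c h) ⟩
      ∑ (interval 1 (suc c)) h ∎
      where open ≡-Reasoning

    ∑-pairs-∷ : {B : Set} (x : B) (xs : List B) (h : B × B → A)
              → ∑ (pairs (x ∷ xs)) h ≡ ∑ xs (λ y → h (x , y)) ⊕ ∑ (pairs xs) h
    ∑-pairs-∷ x xs h = trans (∑-++ (map (x ,_) xs) (pairs xs) h) (cong (_⊕ ∑ (pairs xs) h) (∑-map (x ,_) xs h))

    ∑-pairs-interval : ∀ N lo k (U : ℕ → ℕ → A) → lo + k ≡ N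
      → ∑ (pairs (interval lo k)) (λ p → U (proj₁ p) (N ∸ proj₂ p)) ≡ ∑ (interval lo k) (λ a → ∑ (interval 1 (N ∸ suc a)) (U a))
    ∑-pairs-interval N lo zero    U _ = refl
    ∑-pairs-interval N lo (suc k) U refl = begin
      ∑ (pairs (interval lo (suc k))) (λ p → U (proj₁ p) (N ∸ proj₂ p))
        ≡⟨ ∑-pairs-∷ lo (interval (suc lo) k) _ ⟩
      ∑ (interval (suc lo) k) (λ b → U lo (lo + suc k ∸ b)) ⊕ ∑ (pairs (interval (suc lo) k)) (λ p → U (proj₁ p) (N ∸ proj₂ p))
        ≡⟨ cong₂ _⊕_ first (∑-pairs-interval N (suc lo) k U (sym (+-suc lo k))) ⟩
      ∑ (interval 1 (N ∸ suc lo)) (U lo) ⊕ ∑ (interval (suc lo) k) (λ a → ∑ (interval 1 (N ∸ suc a)) (U a))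
        ∎
      where
      open ≡-Reasoning
      first : ∑ (interval (suc lo) k) (λ b → U lo (lo + suc k ∸ b)) ≡ ∑ (interval 1 (N ∸ suc lo)) (U lo)
      first = begin
        ∑ (interval (suc lo) k) (λ b → U lo (lo + suc k ∸ b))
          ≡⟨ ∑-cong (interval (suc lo) k) (λ b → cong (λ z → U lo (z ∸ b)) (+-suc lo k)) ⟩
        ∑ (interval (suc lo) k) (λ b → U lo (suc lo + k ∸ b))
          ≡⟨ ∑-reverse k (suc lo) (U lo) ⟩
        ∑ (interval 1 k) (U lo)
          ≡⟨ cong (λ z → ∑ (interval 1 z) (U lo)) (sym (trans (cong (_∸ suc lo) (+-suc lo k)) (m+n∸m≡n (suc lo) k))) ⟩
        ∑ (interval 1 (N ∸ suc lo)) (U lo) ∎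

    diagonal : (ℕ → ℕ → A) → ℕ → A
    diagonal U s = ∑ (interval 1 (s ∸ 1)) (λ a → U a (s ∸ a))

    ∑-triangle-by-diagonals : ∀ K (U : ℕ → ℕ → A)
      → ∑ (interval 1 K) (λ a → ∑ (interval 1 (K ∸ a)) (U a)) ≡ ∑ (interval 2 (K ∸ 1)) (diagonal U)
    ∑-triangle-by-diagonals zero          U = refl
    ∑-triangle-by-diagonals (suc zero)    U = identityˡ ε
    ∑-triangle-by-diagonals (suc (suc K)) U = begin
      ∑ (interval 1 (2 + K)) (λ a → ∑ (interval 1 (2 + K ∸ a)) (U a))
        ≡⟨ ∑-snoc 1 (suc K) _ ⟩
      ∑ (interval 1 (1 + K)) (λ a → ∑ (interval 1 (2 + K ∸ a)) (U a)) ⊕ ∑ (interval 1 (1 + K ∸ (1 + K))) (U (2 + K))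
        ≡⟨ cong₂ _⊕_ new-diagonal (cong (λ z → ∑ (interval 1 z) (U (2 + K))) (n∸n≡0 K)) ⟩
      (∑ (interval 1 (1 + K)) (λ a → ∑ (interval 1 (1 + K ∸ a)) (U a)) ⊕ diagonal U (2 + K)) ⊕ ε
        ≡⟨ identityʳ _ ⟩
      ∑ (interval 1 (1 + K)) (λ a → ∑ (interval 1 (1 + K ∸ a)) (U a)) ⊕ diagonal U (2 + K)
        ≡⟨ cong (_⊕ diagonal U (2 + K)) (∑-triangle-by-diagonals (suc K) U) ⟩
      ∑ (interval 2 K) (diagonal U) ⊕ diagonal U (2 + K)
        ≡⟨ sym (∑-snoc 2 K (diagonal U)) ⟩
      ∑ (interval 2 (suc K)) (diagonal U) ∎
      where
      open ≡-Reasoning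
      new-diagonal : ∑ (interval 1 (1 + K)) (λ a → ∑ (interval 1 (2 + K ∸ a)) (U a))
                   ≡ ∑ (interval 1 (1 + K)) (λ a → ∑ (interval 1 (1 + K ∸ a)) (U a)) ⊕ diagonal U (2 + K)
      new-diagonal = trans (∑-congᴵ 1 (1 + K) (λ a _ a<2+K → begin
          ∑ (interval 1 (2 + K ∸ a)) (U a)
            ≡⟨ cong (λ z → ∑ (interval 1 z) (U a)) (+-∸-assoc 1 (≤-pred a<2+K)) ⟩
          ∑ (interval 1 (suc (1 + K ∸ a))) (U a)
            ≡⟨ ∑-snoc 1 (1 + K ∸ a) (U a) ⟩
          ∑ (interval 1 (1 + K ∸ a)) (U a) ⊕ U a (1 + (1 + K ∸ a))
            ≡⟨ cong (λ z → ∑ (interval 1 (1 + K ∸ a)) (U a) ⊕ U a z) (sym (+-∸-assoc 1 (≤-pred a<2+K))) ⟩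
          ∑ (interval 1 (1 + K ∸ a)) (U a) ⊕ U a (2 + K ∸ a) ∎))
        (∑-⊕ (interval 1 (1 + K)) _ _)

    diagonal-+2 : ∀ s (U : ℕ → ℕ → A) → 1 ≤ s
                → diagonal U (2 + s) ≡ (diagonal (λ a b → U a (2 + b)) s ⊕ U s 2) ⊕ U (suc s) 1
    diagonal-+2 (suc s) U _ = begin
      ∑ (interval 1 (2 + s)) F                      ≡⟨ ∑-snoc 1 (1 + s) F ⟩
      ∑ (interval 1 (1 + s)) F ⊕ F (2 + s)          ≡⟨ cong (_⊕ F (2 + s)) (∑-snoc 1 s F) ⟩
      (∑ (interval 1 s) F ⊕ F (1 + s)) ⊕ F (2 + s)
        ≡⟨ cong₂ (λ x y → (x ⊕ U (1 + s) y) ⊕ U (2 + s) (3 + s ∸ (2 + s))) shifted (m+n∸n≡m 2 s) ⟩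
      (G ⊕ U (suc s) 2) ⊕ U (2 + s) (3 + s ∸ (2 + s))
        ≡⟨ cong (λ z → (G ⊕ U (suc s) 2) ⊕ U (2 + s) z) (m+n∸n≡m 1 s) ⟩
      (G ⊕ U (suc s) 2) ⊕ U (2 + s) 1 ∎
      where
      open ≡-Reasoning
      F : ℕ → A
      F a = U a (3 + s ∸ a)
      G : A
      G = diagonal (λ a b → U a (2 + b)) (suc s)
      shifted : ∑ (interval 1 s) F ≡ G
      shifted = ∑-congᴵ 1 s (λ a _ a<1+s → cong (U a) (+-∸-assoc 2 (≤-trans (≤-pred a<1+s) (n≤1+n s))))

    ∑-pointwise : {B : Set} (xs : List B) (h : B → A) {ys : List A}
                → Pointwise (λ x y → h x ≡ y) xs ys → ∑ xs h ≡ Data.List.foldr _⊕_ ε ys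
    ∑-pointwise []       h []       = refl
    ∑-pointwise (x ∷ xs) h (e ∷ es) = cong₂ _⊕_ e (∑-pointwise xs h es)

  module ℕSum = Summation +-0-isCommutativeMonoid
  module ℚSum = Summation ℚP.+-0-isCommutativeMonoid
  open ℕSum using () renaming (∑ to ∑ℕ)
  open ℚSum using () renaming (∑ to ∑ℚ)

  ∑ℕ-*ʳ : {B : Set} (xs : List B) (h : B → ℕ) (c : ℕ) → ∑ℕ xs (λ x → h x * c) ≡ ∑ℕ xs h * c
  ∑ℕ-*ʳ []       h c = refl
  ∑ℕ-*ʳ (x ∷ xs) h c = trans (cong (h x * c +_) (∑ℕ-*ʳ xs h c)) (sym (*-distribʳ-+ c (h x) (∑ℕ xs h)))

  count : {A : Set} → (A → Bool) → List A → ℕ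
  count b []       = 0
  count b (x ∷ xs) = if b x then suc (count b xs) else count b xs

  length-filter≡count : {A : Set} {P : A → Set} (P? : ∀ x → Dec (P x)) (xs : List A)
                      → length (filter P? xs) ≡ count (does ∘ P?) xs
  length-filter≡count P? []       = refl
  length-filter≡count P? (x ∷ xs) with does (P? x)
  ... | true  = cong suc (length-filter≡count P? xs)
  ... | false = length-filter≡count P? xs

  does-≟-true : ∀ b → does (b Bool.≟ true) ≡ b
  does-≟-true true  = refl
  does-≟-true false = refl

  count-filter : {A : Set} {P : A → Set} (P? : ∀ x → Dec (P x)) (b : A → Bool) (xs : List A)
               → count b (filter P? xs) ≡ count (λ x → does (P? x) ∧ b x) xs
  count-filter P? b []       = refl
  count-filter P? b (x ∷ xs) with does (P? x)
  ... | false = count-filter P? b xs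
  ... | true with b x
  ...   | true  = cong suc (count-filter P? b xs)
  ...   | false = count-filter P? b xs

  count-++ : {A : Set} (b : A → Bool) (xs ys : List A) → count b (xs ++ ys) ≡ count b xs + count b ys
  count-++ b []       ys = refl
  count-++ b (x ∷ xs) ys with b x
  ... | true  = cong suc (count-++ b xs ys)
  ... | false = count-++ b xs ys

  count-map : {A B : Set} (b : B → Bool) (f : A → B) (xs : List A) → count b (map f xs) ≡ count (b ∘ f) xs
  count-map b f []       = refl
  count-map b f (x ∷ xs) with b (f x)
  ... | true  = cong suc (count-map b f xs)
  ... | false = count-map b f xs

  count-concatMap : {A B : Set} (b : B → Bool) (g : A → List B) (xs : List A)
                  → count b (concatMap g xs) ≡ ∑ℕ xs (count b ∘ g)
  count-concatMap b g []       = refl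
  count-concatMap b g (x ∷ xs) =
    trans (count-++ b (g x) (concatMap g xs)) (cong (count b (g x) +_) (count-concatMap b g xs))

  count-congᴬ : {A : Set} {b c : A → Bool} {xs : List A} → All (λ x → b x ≡ c x) xs → count b xs ≡ count c xs
  count-congᴬ [] = refl
  count-congᴬ {b = b} {c} {x ∷ xs} (e ∷ es) with b x | c x
  ... | true  | true  = cong suc (count-congᴬ es)
  ... | false | false = count-congᴬ es
  ... | true  | false with () ← e
  ... | false | true  with () ← e

  count-cong : {A : Set} {b c : A → Bool} (xs : List A) → (∀ x → b x ≡ c x) → count b xs ≡ count c xs
  count-cong xs e = count-congᴬ {xs = xs} (All.tabulate (λ {x} _ → e x))

  count-∧-≤ : {A : Set} (b c : A → Bool) (xs : List A) → count (λ x → b x ∧ c x) xs ≤ count b xs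
  count-∧-≤ b c []       = z≤n
  count-∧-≤ b c (x ∷ xs) with b x
  ... | false = count-∧-≤ b c xs
  ... | true with c x
  ...   | true  = s≤s (count-∧-≤ b c xs)
  ...   | false = m≤n⇒m≤1+n (count-∧-≤ b c xs)

  -- Guarded values and natural-number arithmetic

  ifEq : ℕ → ℕ → ℕ → ℕ
  ifEq zero    zero    x = x
  ifEq zero    (suc b) x = 0
  ifEq (suc a) zero    x = 0
  ifEq (suc a) (suc b) x = ifEq a b x

  ifEq-yes : ∀ {a b} x → a ≡ b → ifEq a b x ≡ x
  ifEq-yes {zero}  x refl = refl
  ifEq-yes {suc a} x refl = ifEq-yes {a} x refl

  ifEq-no : ∀ {a b} x → a ≢ b → ifEq a b x ≡ 0
  ifEq-no {zero}  {zero}  x a≢b = ⊥-elim (a≢b refl)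
  ifEq-no {zero}  {suc b} x a≢b = refl
  ifEq-no {suc a} {zero}  x a≢b = refl
  ifEq-no {suc a} {suc b} x a≢b = ifEq-no {a} {b} x (a≢b ∘ cong suc)

  ifEq-+ : ∀ a b x y → ifEq a b (x + y) ≡ ifEq a b x + ifEq a b y
  ifEq-+ zero    zero    x y = refl
  ifEq-+ zero    (suc b) x y = refl
  ifEq-+ (suc a) zero    x y = refl
  ifEq-+ (suc a) (suc b) x y = ifEq-+ a b x y

  ifEq-*ʳ : ∀ a b x c → ifEq a b (x * c) ≡ ifEq a b x * c
  ifEq-*ʳ zero    zero    x c = refl
  ifEq-*ʳ zero    (suc b) x c = refl
  ifEq-*ʳ (suc a) zero    x c = refl
  ifEq-*ʳ (suc a) (suc b) x c = ifEq-*ʳ a b x c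

  ifEq-comm : ∀ a b x → ifEq a b x ≡ ifEq b a x
  ifEq-comm zero    zero    x = refl
  ifEq-comm zero    (suc b) x = refl
  ifEq-comm (suc a) zero    x = refl
  ifEq-comm (suc a) (suc b) x = ifEq-comm a b x

  ifEq-+-cancelʳ : ∀ a b d x → ifEq (a + d) (b + d) x ≡ ifEq a b x
  ifEq-+-cancelʳ a b d x with a ≟ b
  ... | yes refl = trans (ifEq-yes {a + d} x refl) (sym (ifEq-yes {a} x refl))
  ... | no a≢b   = trans (ifEq-no x (a≢b ∘ +-cancelʳ-≡ d a b)) (sym (ifEq-no x a≢b))

  ifLE : ℕ → ℕ → ℕ → ℕ
  ifLE zero    b       x = x
  ifLE (suc a) zero    x = 0
  ifLE (suc a) (suc b) x = ifLE a b x

  ifLE-yes : ∀ {a b} x → a ≤ b → ifLE a b x ≡ x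
  ifLE-yes x z≤n       = refl
  ifLE-yes x (s≤s a≤b) = ifLE-yes x a≤b

  ifLE-no : ∀ {a b} x → ¬ a ≤ b → ifLE a b x ≡ 0
  ifLE-no {zero}          x a≰b = ⊥-elim (a≰b z≤n)
  ifLE-no {suc a} {zero}  x a≰b = refl
  ifLE-no {suc a} {suc b} x a≰b = ifLE-no {a} {b} x (a≰b ∘ s≤s)

  ifLE-+ : ∀ a b x y → ifLE a b (x + y) ≡ ifLE a b x + ifLE a b y
  ifLE-+ zero    b       x y = refl
  ifLE-+ (suc a) zero    x y = refl
  ifLE-+ (suc a) (suc b) x y = ifLE-+ a b x y

  ifLE-0 : ∀ a b → ifLE a b 0 ≡ 0
  ifLE-0 zero    b       = refl
  ifLE-0 (suc a) zero    = refl
  ifLE-0 (suc a) (suc b) = ifLE-0 a b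

  ifLE-∑ : {A : Set} (xs : List A) (a b : ℕ) (h : A → ℕ) → ∑ℕ xs (λ x → ifLE a b (h x)) ≡ ifLE a b (∑ℕ xs h)
  ifLE-∑ []       a b h = sym (ifLE-0 a b)
  ifLE-∑ (x ∷ xs) a b h = trans (cong (ifLE a b (h x) +_) (ifLE-∑ xs a b h)) (sym (ifLE-+ a b (h x) (∑ℕ xs h)))

  ≤-lit : ∀ {a b} {p : True (a ≤? b)} → a ≤ b
  ≤-lit {p = p} = toWitness p

  ∸-split : ∀ c a n → c + a ≤ n → n ∸ a ≡ c + (n ∸ (c + a))
  ∸-split c a n c+a≤n = begin
    n ∸ a                            ≡⟨ cong (_∸ a) (sym (m∸n+n≡m c+a≤n)) ⟩
    (n ∸ (c + a) + (c + a)) ∸ a      ≡⟨ cong (_∸ a) (sym (+-assoc (n ∸ (c + a)) c a)) ⟩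
    (n ∸ (c + a) + c + a) ∸ a        ≡⟨ m+n∸n≡m (n ∸ (c + a) + c) a ⟩
    n ∸ (c + a) + c                  ≡⟨ +-comm (n ∸ (c + a)) c ⟩
    c + (n ∸ (c + a))                ∎
    where open ≡-Reasoning

  double-≤-cancel : ∀ {x y} → x + x ≤ y + y → x ≤ y
  double-≤-cancel {x} {y} x+x≤y+y with x ≤? y
  ... | yes x≤y = x≤y
  ... | no x≰y  = ⊥-elim (<-irrefl refl (<-≤-trans (+-mono-< (≰⇒> x≰y) (≰⇒> x≰y)) x+x≤y+y))

  double-<-cancel : ∀ {x y} → x + x < y + y → x < y
  double-<-cancel {x} {y} x+x<y+y with x <? y
  ... | yes x<y = x<y
  ... | no x≮y  = ⊥-elim (<-irrefl refl (<-≤-trans x+x<y+y (+-mono-≤ (≮⇒≥ x≮y) (≮⇒≥ x≮y))))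

  ≤-+-⊓ : ∀ X A A′ B B′ → X ≤ A + B → X ≤ A′ + B → X ≤ A + B′ → X ≤ A′ + B′ → X ≤ (A ⊓ A′) + (B ⊓ B′)
  ≤-+-⊓ X A A′ B B′ h₁ h₂ h₃ h₄ with ⊓-sel A A′ | ⊓-sel B B′
  ... | inj₁ p | inj₁ q rewrite p | q = h₁
  ... | inj₂ p | inj₁ q rewrite p | q = h₂
  ... | inj₁ p | inj₂ q rewrite p | q = h₃
  ... | inj₂ p | inj₂ q rewrite p | q = h₄

  <-+-⊓ : ∀ X A A′ B B′ → X < A + B → X < A′ + B → X < A + B′ → X < A′ + B′ → X < (A ⊓ A′) + (B ⊓ B′)
  <-+-⊓ X = ≤-+-⊓ (suc X)

  twice : ℕ → ℕ
  twice zero    = 0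
  twice (suc q) = suc (suc (twice q))

  twice≡+ : ∀ q → twice q ≡ q + q
  twice≡+ zero    = refl
  twice≡+ (suc q) = cong suc (trans (cong suc (twice≡+ q)) (sym (+-suc q q)))

  twice-or-1+twice : ∀ s → ∃ λ q → s ≡ twice q ⊎ s ≡ suc (twice q)
  twice-or-1+twice zero = 0 , inj₁ refl
  twice-or-1+twice (suc s) with twice-or-1+twice s
  ... | q , inj₁ refl = q , inj₂ refl
  ... | q , inj₂ refl = suc q , inj₁ refl

  ⌊1+twice/2⌋ : ∀ q → ⌊ 1 + twice q /2⌋ ≡ q
  ⌊1+twice/2⌋ zero    = refl
  ⌊1+twice/2⌋ (suc q) = cong suc (⌊1+twice/2⌋ q)

  ⌊twice/2⌋ : ∀ q → ⌊ twice q /2⌋ ≡ q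
  ⌊twice/2⌋ zero    = refl
  ⌊twice/2⌋ (suc q) = cong suc (⌊twice/2⌋ q)

  ⌊+twice/2⌋ : ∀ c r → ⌊ c + twice r /2⌋ ≡ ⌊ c /2⌋ + r
  ⌊+twice/2⌋ 0             r = ⌊twice/2⌋ r
  ⌊+twice/2⌋ 1             r = ⌊1+twice/2⌋ r
  ⌊+twice/2⌋ (suc (suc c)) r = cong suc (⌊+twice/2⌋ c r)

  -- Walk counts in GP(n,2)

  ≟V-refl : ∀ {n} (x : Vertex n) → does (x ≟V x) ≡ true
  ≟V-refl x with x ≟V x
  ... | yes _   = refl
  ... | no x≢x = ⊥-elim (x≢x refl)

  module Walks (n : ℕ) .{{_ : NonZero n}} where

    walkCount : ℕ → Vertex n → Vertex n → ℕ
    walkCount k s t = count (endsAt t) (walks n k s)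

    walkCountVia : ℕ → Vertex n → Vertex n → Vertex n → ℕ
    walkCountVia k s t x = count (λ p → endsAt t p ∧ does (x ∈? p)) (walks n k s)

    walkCount-zero : ∀ s t → walkCount 0 s t ≡ (if does (s ≟V t) then 1 else 0)
    walkCount-zero s t with does (s ≟V t)
    ... | true  = refl
    ... | false = refl

    walks-start : ∀ k w → All (λ p → ∃ λ q → p ≡ w ∷ q) (walks n k w)
    walks-start zero    w = (_ , refl) ∷ []
    walks-start (suc k) w = go (nbrs n w)
      where
      go : ∀ ys → All (λ p → ∃ λ q → p ≡ w ∷ q) (concatMap (λ y → map (w ∷_) (walks n k y)) ys)
      go []       = []
      go (y ∷ ys) = AllP.++⁺ (AllP.map⁺ (All.universal (λ p → p , refl) (walks n k y))) (go ys)

    count-walks-suc : ∀ (b : List (Vertex n) → Bool) k s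
                    → count b (walks n (suc k) s) ≡ ∑ℕ (nbrs n s) (λ y → count (b ∘ (s ∷_)) (walks n k y))
    count-walks-suc b k s = trans (count-concatMap b _ (nbrs n s))
                                  (ℕSum.∑-cong (nbrs n s) (λ y → count-map b (s ∷_) (walks n k y)))

    walkCount-suc : ∀ k s t → walkCount (suc k) s t ≡ ∑ℕ (nbrs n s) (λ y → walkCount k y t)
    walkCount-suc k s t = trans (count-walks-suc (endsAt t) k s) (ℕSum.∑-cong (nbrs n s) (λ y →
      count-congᴬ (All.map (λ { (q , refl) → refl }) (walks-start k y))))

    walkCountVia-suc : ∀ k s t x → x ≢ s → walkCountVia (suc k) s t x ≡ ∑ℕ (nbrs n s) (λ y → walkCountVia k y t x)
    walkCountVia-suc k s t x x≢s = trans (count-walks-suc _ k s) (ℕSum.∑-cong (nbrs n s) (λ y →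
      count-congᴬ (All.map (λ { (q , refl) → cong (λ z → endsAt t (y ∷ q) ∧ (z ∨ does (x ∈? (y ∷ q)))) x≟s }) (walks-start k y))))
      where
      x≟s : does (x ≟V s) ≡ false
      x≟s with x ≟V s
      ... | yes x≡s = ⊥-elim (x≢s x≡s)
      ... | no _    = refl

    walkCountVia-source : ∀ k s t → walkCountVia k s t s ≡ walkCount k s t
    walkCountVia-source k s t = count-congᴬ (All.map (λ { (q , refl) → begin
        endsAt t (s ∷ q) ∧ (does (s ≟V s) ∨ does (s ∈? q)) ≡⟨ cong (λ z → endsAt t (s ∷ q) ∧ (z ∨ does (s ∈? q))) (≟V-refl s) ⟩
        endsAt t (s ∷ q) ∧ true                           ≡⟨ Bool.∧-identityʳ (endsAt t (s ∷ q)) ⟩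
        endsAt t (s ∷ q)                                  ∎ }) (walks-start k s))
      where open ≡-Reasoning

  module Certificate (n : ℕ) .{{_ : NonZero n}} (t : Vertex n) (E N : Vertex n → ℕ)
    (E≡0⇒t : ∀ s → E s ≡ 0 → s ≡ t)
    (E-t : E t ≡ 0)
    (E-lipschitz : ∀ s → All (λ y → E s ≤ suc (E y)) (nbrs n s))
    (N-t : N t ≡ 1)
    (N-rec : ∀ s → s ≢ t → N s ≡ ∑ℕ (nbrs n s) (λ y → ifEq (suc (E y)) (E s) (N y)))
    where

    open Walks n

    walkCount-short : ∀ k s → k < E s → walkCount k s t ≡ 0
    walkCount-short zero s 0<Es with s ≟V t
    ... | yes refl = ⊥-elim (<-irrefl (sym E-t) 0<Es)
    ... | no _     = refl
    walkCount-short (suc k) s k<Es = begin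
      walkCount (suc k) s t                ≡⟨ walkCount-suc k s t ⟩
      ∑ℕ (nbrs n s) (λ y → walkCount k y t) ≡⟨ ℕSum.∑-congᴬ (All.map IH (E-lipschitz s)) ⟩
      ∑ℕ (nbrs n s) (λ _ → 0)               ≡⟨ ℕSum.∑-ε (nbrs n s) ⟩
      0                                    ∎
      where
      open ≡-Reasoning
      IH : ∀ {y} → E s ≤ suc (E y) → walkCount k y t ≡ 0
      IH l = walkCount-short k _ (≤-pred (≤-trans k<Es l))

    walkCount-exact : ∀ k s → E s ≡ k → walkCount k s t ≡ N s
    walkCount-exact zero s Es≡0 with E≡0⇒t s Es≡0
    ... | refl = trans (walkCount-zero t t) (trans (cong (λ b → if b then 1 else 0) (≟V-refl t)) (sym N-t))
    walkCount-exact (suc k) s Es≡1+k = begin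
      walkCount (suc k) s t                                 ≡⟨ walkCount-suc k s t ⟩
      ∑ℕ (nbrs n s) (λ y → walkCount k y t)                  ≡⟨ ℕSum.∑-congᴬ (All.map step (E-lipschitz s)) ⟩
      ∑ℕ (nbrs n s) (λ y → ifEq (suc (E y)) (E s) (N y))     ≡⟨ sym (N-rec s s≢t) ⟩
      N s                                                   ∎
      where
      open ≡-Reasoning
      s≢t : s ≢ t
      s≢t refl = 0≢1+n (trans (sym E-t) Es≡1+k)
      step : ∀ {y} → E s ≤ suc (E y) → walkCount k y t ≡ ifEq (suc (E y)) (E s) (N y)
      step {y} l with suc (E y) ≟ E s
      ... | yes e  = trans (walkCount-exact k y (suc-injective (trans e Es≡1+k))) (sym (ifEq-yes (N y) e))
      ... | no ¬e = trans (walkCount-short k y (≤∧≢⇒< (≤-pred (subst (_≤ suc (E y)) Es≡1+k l))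
                                                     (λ k≡Ey → ¬e (trans (cong suc (sym k≡Ey)) (sym Es≡1+k)))))
                          (sym (ifEq-no (N y) ¬e))

    module Through (t′ : Vertex n) (t′≢t : t′ ≢ t) (D M : ℕ) (1≤D : 1 ≤ D)
      (t-short : ∀ k → k < D → walkCount k t t′ ≡ 0) (t-exact : walkCount D t t′ ≡ M) where

      walkCount-from-t : ∀ k → k ≤ D → walkCount k t t′ ≡ ifEq k D M
      walkCount-from-t k k≤D with k ≟ D
      ... | yes refl = trans t-exact (sym (ifEq-yes {k} M refl))
      ... | no k≢D   = trans (t-short k (≤∧≢⇒< k≤D k≢D)) (sym (ifEq-no M k≢D))

      walkCountVia-zero : ∀ s → walkCountVia 0 s t′ t ≡ 0
      walkCountVia-zero s with s ≟V t′ | t ≟V s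
      ... | no _     | _        = refl
      ... | yes refl | no _     = refl
      ... | yes refl | yes refl = ⊥-elim (t′≢t refl)

      walkCountVia-t : ∀ k s → k ≤ E s + D → walkCountVia k s t′ t ≡ ifEq k (E s + D) (N s * M)
      walkCountVia-t k s k≤ with t ≟V s
      walkCountVia-t k .t k≤ | yes refl = begin
        walkCountVia k t t′ t       ≡⟨ walkCountVia-source k t t′ ⟩
        walkCount k t t′            ≡⟨ walkCount-from-t k (subst (λ e → k ≤ e + D) E-t k≤) ⟩
        ifEq k D M                  ≡⟨ cong₂ (λ e c → ifEq k (e + D) c) (sym E-t) (sym (trans (cong (_* M) N-t) (+-identityʳ M))) ⟩
        ifEq k (E t + D) (N t * M)  ∎
        where open ≡-Reasoning
      walkCountVia-t zero s k≤ | no t≢s =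
        trans (walkCountVia-zero s) (sym (ifEq-no _ (λ 0≡ → <-irrefl 0≡ (≤-trans 1≤D (m≤n+m D (E s))))))
      walkCountVia-t (suc k) s k≤ | no t≢s = begin
        walkCountVia (suc k) s t′ t                       ≡⟨ walkCountVia-suc k s t′ t t≢s ⟩
        ∑ℕ (nbrs n s) (λ y → walkCountVia k y t′ t)         ≡⟨ ℕSum.∑-congᴬ (All.map IH (E-lipschitz s)) ⟩
        ∑ℕ (nbrs n s) (λ y → ifEq k (E y + D) (N y * M))    ≡⟨ last-step (suc k ≟ E s + D) ⟩
        ifEq (suc k) (E s + D) (N s * M)                  ∎
        where
        open ≡-Reasoning
        IH : ∀ {y} → E s ≤ suc (E y) → walkCountVia k y t′ t ≡ ifEq k (E y + D) (N y * M)
        IH l = walkCountVia-t k _ (≤-pred (≤-trans k≤ (+-monoˡ-≤ D l)))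
        last-step : Dec (suc k ≡ E s + D)
                  → ∑ℕ (nbrs n s) (λ y → ifEq k (E y + D) (N y * M)) ≡ ifEq (suc k) (E s + D) (N s * M)
        last-step (yes e) = begin
          ∑ℕ (nbrs n s) (λ y → ifEq k (E y + D) (N y * M))      ≡⟨ ℕSum.∑-cong (nbrs n s) term ⟩
          ∑ℕ (nbrs n s) (λ y → ifEq (suc (E y)) (E s) (N y) * M) ≡⟨ ∑ℕ-*ʳ (nbrs n s) _ M ⟩
          ∑ℕ (nbrs n s) (λ y → ifEq (suc (E y)) (E s) (N y)) * M ≡⟨ cong (_* M) (sym (N-rec s (t≢s ∘ sym))) ⟩
          N s * M                                               ≡⟨ sym (ifEq-yes _ e) ⟩
          ifEq (suc k) (E s + D) (N s * M)                      ∎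
          where
          term : ∀ y → ifEq k (E y + D) (N y * M) ≡ ifEq (suc (E y)) (E s) (N y) * M
          term y = begin
            ifEq (suc k) (suc (E y) + D) (N y * M) ≡⟨ cong (λ a → ifEq a (suc (E y) + D) (N y * M)) e ⟩
            ifEq (E s + D) (suc (E y) + D) (N y * M) ≡⟨ ifEq-+-cancelʳ (E s) (suc (E y)) D _ ⟩
            ifEq (E s) (suc (E y)) (N y * M)        ≡⟨ ifEq-comm (E s) (suc (E y)) _ ⟩
            ifEq (suc (E y)) (E s) (N y * M)        ≡⟨ ifEq-*ʳ (suc (E y)) (E s) (N y) M ⟩
            ifEq (suc (E y)) (E s) (N y) * M        ∎
        last-step (no ¬e) = begin
          ∑ℕ (nbrs n s) (λ y → ifEq k (E y + D) (N y * M)) ≡⟨ ℕSum.∑-congᴬ (All.map term (E-lipschitz s)) ⟩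
          ∑ℕ (nbrs n s) (λ _ → 0)                          ≡⟨ ℕSum.∑-ε (nbrs n s) ⟩
          0                                               ≡⟨ sym (ifEq-no _ ¬e) ⟩
          ifEq (suc k) (E s + D) (N s * M)                ∎
          where
          term : ∀ {y} → E s ≤ suc (E y) → ifEq k (E y + D) (N y * M) ≡ 0
          term l = ifEq-no _ (λ k≡ → ¬e (≤-antisym k≤ (subst (E s + D ≤_) (cong suc (sym k≡)) (+-monoˡ-≤ D l))))

  module Rotation (n : ℕ) .{{_ : NonZero n}} where

    open Walks n

    toℕ-shift : ∀ r i → toℕ (shift n r i) ≡ (toℕ i + r) % n
    toℕ-shift r i = toℕ-fromℕ< _

    toℕ-shift-shift : ∀ r a i → toℕ (shift n a (shift n r i)) ≡ (toℕ i + r + a) % n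
    toℕ-shift-shift r a i = begin
      toℕ (shift n a (shift n r i))      ≡⟨ toℕ-shift a (shift n r i) ⟩
      (toℕ (shift n r i) + a) % n         ≡⟨ cong (λ z → (z + a) % n) (toℕ-shift r i) ⟩
      ((toℕ i + r) % n + a) % n          ≡⟨ %-distribˡ-+ ((toℕ i + r) % n) a n ⟩
      ((toℕ i + r) % n % n + a % n) % n  ≡⟨ cong (λ z → (z + a % n) % n) (m%n%n≡m%n (toℕ i + r) n) ⟩
      ((toℕ i + r) % n + a % n) % n      ≡⟨ sym (%-distribˡ-+ (toℕ i + r) a n) ⟩
      (toℕ i + r + a) % n                ∎
      where open ≡-Reasoning

    shift-comm : ∀ a r i → shift n a (shift n r i) ≡ shift n r (shift n a i)
    shift-comm a r i = toℕ-injective (begin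
      toℕ (shift n a (shift n r i))  ≡⟨ toℕ-shift-shift r a i ⟩
      (toℕ i + r + a) % n            ≡⟨ cong (_% n) (+-assoc (toℕ i) r a) ⟩
      (toℕ i + (r + a)) % n          ≡⟨ cong (λ z → (toℕ i + z) % n) (+-comm r a) ⟩
      (toℕ i + (a + r)) % n          ≡⟨ cong (_% n) (sym (+-assoc (toℕ i) a r)) ⟩
      (toℕ i + a + r) % n            ≡⟨ sym (toℕ-shift-shift a r i) ⟩
      toℕ (shift n r (shift n a i))  ∎)
      where open ≡-Reasoning

    shift-inverse : ∀ r i → r ≤ n → shift n (n ∸ r) (shift n r i) ≡ i
    shift-inverse r i r≤n = toℕ-injective (begin
      toℕ (shift n (n ∸ r) (shift n r i))  ≡⟨ toℕ-shift-shift r (n ∸ r) i ⟩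
      (toℕ i + r + (n ∸ r)) % n            ≡⟨ cong (_% n) (+-assoc (toℕ i) r (n ∸ r)) ⟩
      (toℕ i + (r + (n ∸ r))) % n          ≡⟨ cong (λ z → (toℕ i + z) % n) (m+[n∸m]≡n r≤n) ⟩
      (toℕ i + n) % n                      ≡⟨ [m+n]%n≡m%n (toℕ i) n ⟩
      toℕ i % n                            ≡⟨ m<n⇒m%n≡m (toℕ<n i) ⟩
      toℕ i                                ∎)
      where open ≡-Reasoning

    rotate : ℕ → Vertex n → Vertex n
    rotate r (u i) = u (shift n r i)
    rotate r (v i) = v (shift n r i)

    nbrs-rotate : ∀ r x → nbrs n (rotate r x) ≡ map (rotate r) (nbrs n x)
    nbrs-rotate r (u i) = cong₂ (λ a b → u a ∷ u b ∷ v (shift n r i) ∷ []) (shift-comm 1 r i) (shift-comm (n ∸ 1) r i)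
    nbrs-rotate r (v i) = cong₂ (λ a b → v a ∷ v b ∷ u (shift n r i) ∷ []) (shift-comm 2 r i) (shift-comm (n ∸ 2) r i)

    rotate-inverse : ∀ r x → r ≤ n → rotate (n ∸ r) (rotate r x) ≡ x
    rotate-inverse r (u i) r≤n = cong u (shift-inverse r i r≤n)
    rotate-inverse r (v i) r≤n = cong v (shift-inverse r i r≤n)

    rotate-≟V : ∀ r s t → r ≤ n → does (rotate r s ≟V rotate r t) ≡ does (s ≟V t)
    rotate-≟V r s t r≤n with s ≟V t | rotate r s ≟V rotate r t
    ... | yes refl | yes _  = refl
    ... | yes refl | no ≢   = ⊥-elim (≢ refl)
    ... | no _     | no _   = refl
    ... | no s≢t   | yes eq = ⊥-elim (s≢t (begin
      s                            ≡⟨ sym (rotate-inverse r s r≤n) ⟩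
      rotate (n ∸ r) (rotate r s)  ≡⟨ cong (rotate (n ∸ r)) eq ⟩
      rotate (n ∸ r) (rotate r t)  ≡⟨ rotate-inverse r t r≤n ⟩
      t                            ∎))
      where open ≡-Reasoning

    walkCount-rotate : ∀ r k s t → r ≤ n → walkCount k (rotate r s) (rotate r t) ≡ walkCount k s t
    walkCount-rotate r zero s t r≤n = begin
      walkCount 0 (rotate r s) (rotate r t)           ≡⟨ walkCount-zero (rotate r s) (rotate r t) ⟩
      (if does (rotate r s ≟V rotate r t) then 1 else 0) ≡⟨ cong (λ b → if b then 1 else 0) (rotate-≟V r s t r≤n) ⟩
      (if does (s ≟V t) then 1 else 0)                 ≡⟨ sym (walkCount-zero s t) ⟩
      walkCount 0 s t                                 ∎
      where open ≡-Reasoning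
    walkCount-rotate r (suc k) s t r≤n = begin
      walkCount (suc k) (rotate r s) (rotate r t)
        ≡⟨ walkCount-suc k (rotate r s) (rotate r t) ⟩
      ∑ℕ (nbrs n (rotate r s)) (λ y → walkCount k y (rotate r t))
        ≡⟨ cong (λ L → ∑ℕ L (λ y → walkCount k y (rotate r t))) (nbrs-rotate r s) ⟩
      ∑ℕ (map (rotate r) (nbrs n s)) (λ y → walkCount k y (rotate r t))
        ≡⟨ ℕSum.∑-map (rotate r) (nbrs n s) _ ⟩
      ∑ℕ (nbrs n s) (λ y → walkCount k (rotate r y) (rotate r t))
        ≡⟨ ℕSum.∑-cong (nbrs n s) (λ y → walkCount-rotate r k y t r≤n) ⟩
      ∑ℕ (nbrs n s) (λ y → walkCount k y t)
        ≡⟨ sym (walkCount-suc k s t) ⟩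
      walkCount (suc k) s t ∎
      where open ≡-Reasoning

  module Geodesics (n : ℕ) .{{_ : NonZero n}} where

    open Walks n

    length-walksTo : ∀ k s t → length (walksTo n k s t) ≡ walkCount k s t
    length-walksTo k s t = trans (length-filter≡count _ (walks n k s))
                                 (count-cong (walks n k s) (λ p → does-≟-true (endsAt t p)))

    length-walksTo-via : ∀ k s t x → length (filter (x ∈?_) (walksTo n k s t)) ≡ walkCountVia k s t x
    length-walksTo-via k s t x = begin
      length (filter (x ∈?_) (walksTo n k s t))
        ≡⟨ length-filter≡count _ (walksTo n k s t) ⟩
      count (λ p → does (x ∈? p)) (walksTo n k s t)
        ≡⟨ count-filter _ _ (walks n k s) ⟩
      count (λ p → does (endsAt t p Bool.≟ true) ∧ does (x ∈? p)) (walks n k s)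
        ≡⟨ count-cong (walks n k s) (λ p → cong (_∧ does (x ∈? p)) (does-≟-true (endsAt t p))) ⟩
      walkCountVia k s t x ∎
      where open ≡-Reasoning

    searchGeo-finds : ∀ fuel k d s t → k ≤ d → d < k + fuel
                    → (∀ j → j < d → walkCount j s t ≡ 0) → 0 < walkCount d s t
                    → searchGeo n fuel k s t ≡ walksTo n d s t
    searchGeo-finds zero k d s t k≤d d<k+0 _ _ = ⊥-elim (<-irrefl refl (<-≤-trans d<k+0 (subst (_≤ d) (sym (+-identityʳ k)) k≤d)))
    searchGeo-finds (suc fuel) k d s t k≤d d<k+fuel shorter exact with walksTo n k s t in eq
    ... | [] = searchGeo-finds fuel (suc k) d s t k<d (subst (d <_) (+-suc k fuel) d<k+fuel) shorter exact
      where
      k<d : k < d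
      k<d = ≤∧≢⇒< k≤d (λ { refl → <-irrefl (trans (sym (cong length eq)) (length-walksTo k s t)) exact })
    ... | p ∷ ps with k ≟ d
    ...   | yes refl = sym eq
    ...   | no k≢d   = ⊥-elim (0≢1+n (trans (sym (shorter k (≤∧≢⇒< k≤d k≢d))) (trans (sym (length-walksTo k s t)) (cong length eq))))

  v-injective : ∀ {n} {i j : Fin n} → v i ≡ v j → i ≡ j
  v-injective refl = refl

  -- Geodesic counts along two competing routes

  minCount : ℕ → ℕ → ℕ → ℕ → ℕ
  minCount a b x y = ifLE a b x + ifLE b a y

  minCount-comm : ∀ a b x y → minCount a b x y ≡ minCount b a y x
  minCount-comm a b x y = +-comm (ifLE a b x) (ifLE b a y)

  minCount-pos : ∀ a b x y → 1 ≤ x → 1 ≤ y → 1 ≤ minCount a b x y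
  minCount-pos a b x y 1≤x 1≤y with ≤-total a b
  ... | inj₁ a≤b = subst (λ z → 1 ≤ z + ifLE b a y) (sym (ifLE-yes x a≤b)) (≤-trans 1≤x (m≤m+n x _))
  ... | inj₂ b≤a = subst (λ z → 1 ≤ ifLE a b x + z) (sym (ifLE-yes y b≤a)) (≤-trans 1≤y (m≤n+m y _))

  ifEq-minCountˡ : ∀ {a b} P x y → a < b → ifEq (suc (a ⊓ b)) P (minCount a b x y) ≡ ifEq (suc a) P x
  ifEq-minCountˡ {a} {b} P x y a<b = begin
    ifEq (suc (a ⊓ b)) P (minCount a b x y)
      ≡⟨ cong₂ (λ z w → ifEq (suc z) P w) (m≤n⇒m⊓n≡m (<⇒≤ a<b)) (cong₂ _+_ (ifLE-yes x (<⇒≤ a<b)) (ifLE-no y (<⇒≱ a<b))) ⟩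
    ifEq (suc a) P (x + 0)                   ≡⟨ cong (ifEq (suc a) P) (+-identityʳ x) ⟩
    ifEq (suc a) P x                         ∎
    where open ≡-Reasoning

  ifEq-⊓-minCountˡ : ∀ P Q a b x y → P < Q → Q ≤ suc b → ifEq (suc (a ⊓ b)) P (minCount a b x y) ≡ ifEq (suc a) P x
  ifEq-⊓-minCountˡ P Q a b x y P<Q Q≤1+b with suc a ≟ P
  ... | yes 1+a≡P = begin
    ifEq (suc (a ⊓ b)) P (minCount a b x y)  ≡⟨ ifEq-minCountˡ P x y a<b ⟩
    ifEq (suc a) P x                         ∎
    where
    open ≡-Reasoning
    a<b : a < b
    a<b = ≤-pred (<-≤-trans (subst (_< Q) (sym 1+a≡P) P<Q) Q≤1+b)
  ... | no 1+a≢P = trans (ifEq-no _ 1+a⊓b≢P) (sym (ifEq-no x 1+a≢P))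
    where
    1+a⊓b≢P : suc (a ⊓ b) ≢ P
    1+a⊓b≢P e with ⊓-sel a b
    ... | inj₁ a⊓b≡a = 1+a≢P (trans (cong suc (sym a⊓b≡a)) e)
    ... | inj₂ a⊓b≡b = <-irrefl refl (<-≤-trans P<Q (subst (Q ≤_) (trans (cong suc (sym a⊓b≡b)) e) Q≤1+b))

  ifEq-⊓-minCount : ∀ P Q a b x y → P ≤ suc a → Q ≤ suc b
    → ifEq (suc (a ⊓ b)) (P ⊓ Q) (minCount a b x y) ≡ ifLE P Q (ifEq (suc a) P x) + ifLE Q P (ifEq (suc b) Q y)
  ifEq-⊓-minCount P Q a b x y P≤1+a Q≤1+b with <-cmp P Q
  ... | tri< P<Q _ _ = begin
    ifEq (suc (a ⊓ b)) (P ⊓ Q) (minCount a b x y)  ≡⟨ cong (λ z → ifEq (suc (a ⊓ b)) z (minCount a b x y)) (m≤n⇒m⊓n≡m (<⇒≤ P<Q)) ⟩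
    ifEq (suc (a ⊓ b)) P (minCount a b x y)        ≡⟨ ifEq-⊓-minCountˡ P Q a b x y P<Q Q≤1+b ⟩
    ifEq (suc a) P x                               ≡⟨ sym (+-identityʳ _) ⟩
    ifEq (suc a) P x + 0                           ≡⟨ sym (cong₂ _+_ (ifLE-yes _ (<⇒≤ P<Q)) (ifLE-no _ (<⇒≱ P<Q))) ⟩
    ifLE P Q (ifEq (suc a) P x) + ifLE Q P (ifEq (suc b) Q y) ∎
    where open ≡-Reasoning
  ... | tri> _ _ Q<P = begin
    ifEq (suc (a ⊓ b)) (P ⊓ Q) (minCount a b x y)  ≡⟨ cong₂ (λ z w → ifEq (suc z) (P ⊓ Q) w) (⊓-comm a b) (minCount-comm a b x y) ⟩
    ifEq (suc (b ⊓ a)) (P ⊓ Q) (minCount b a y x)  ≡⟨ cong (λ z → ifEq (suc (b ⊓ a)) z (minCount b a y x)) (m≥n⇒m⊓n≡n (<⇒≤ Q<P)) ⟩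
    ifEq (suc (b ⊓ a)) Q (minCount b a y x)        ≡⟨ ifEq-⊓-minCountˡ Q P b a y x Q<P P≤1+a ⟩
    ifEq (suc b) Q y                               ≡⟨ sym (cong₂ _+_ (ifLE-no _ (<⇒≱ Q<P)) (ifLE-yes _ (<⇒≤ Q<P))) ⟩
    ifLE P Q (ifEq (suc a) P x) + ifLE Q P (ifEq (suc b) Q y) ∎
    where open ≡-Reasoning
  ... | tri≈ _ refl _ rewrite ⊓-idem P | ifLE-yes {P} (ifEq (suc a) P x) ≤-refl | ifLE-yes {P} (ifEq (suc b) P y) ≤-refl
    with <-cmp a b
  ... | tri< a<b _ _ = begin
    ifEq (suc (a ⊓ b)) P (minCount a b x y)  ≡⟨ ifEq-minCountˡ P x y a<b ⟩
    ifEq (suc a) P x                         ≡⟨ sym (+-identityʳ _) ⟩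
    ifEq (suc a) P x + 0                     ≡⟨ cong (ifEq (suc a) P x +_) (sym (ifEq-no y 1+b≢P)) ⟩
    ifEq (suc a) P x + ifEq (suc b) P y      ∎
    where
    open ≡-Reasoning
    1+b≢P : suc b ≢ P
    1+b≢P e = <-irrefl refl (<-≤-trans (s≤s a<b) (subst (_≤ suc a) (sym e) P≤1+a))
  ... | tri≈ _ refl _ = trans (cong₂ (λ z w → ifEq (suc z) P w) (⊓-idem a) (cong₂ _+_ (ifLE-yes {a} x ≤-refl) (ifLE-yes {a} y ≤-refl)))
                             (ifEq-+ (suc a) P x y)
  ... | tri> _ _ b<a = begin
    ifEq (suc (a ⊓ b)) P (minCount a b x y)  ≡⟨ cong₂ (λ z → ifEq (suc z) P) (⊓-comm a b) (minCount-comm a b x y) ⟩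
    ifEq (suc (b ⊓ a)) P (minCount b a y x)  ≡⟨ ifEq-minCountˡ P y x b<a ⟩
    ifEq (suc b) P y                         ≡⟨ cong (_+ ifEq (suc b) P y) (sym (ifEq-no x 1+a≢P)) ⟩
    ifEq (suc a) P x + ifEq (suc b) P y      ∎
    where
    open ≡-Reasoning
    1+a≢P : suc a ≢ P
    1+a≢P e = <-irrefl refl (<-≤-trans (s≤s b<a) (subst (_≤ suc b) (sym e) Q≤1+b))

  minCount-∑ : {Y : Set} (ys : List Y) (P Q : ℕ) (a b x y : Y → ℕ)
    → All (λ z → P ≤ suc (a z) × Q ≤ suc (b z)) ys
    → minCount P Q (∑ℕ ys (λ z → ifEq (suc (a z)) P (x z))) (∑ℕ ys (λ z → ifEq (suc (b z)) Q (y z)))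
      ≡ ∑ℕ ys (λ z → ifEq (suc (a z ⊓ b z)) (P ⊓ Q) (minCount (a z) (b z) (x z) (y z)))
  minCount-∑ ys P Q a b x y lip = sym (begin
    ∑ℕ ys (λ z → ifEq (suc (a z ⊓ b z)) (P ⊓ Q) (minCount (a z) (b z) (x z) (y z)))
      ≡⟨ ℕSum.∑-congᴬ (All.map (λ { (la , lb) → ifEq-⊓-minCount P Q _ _ _ _ la lb }) lip) ⟩
    ∑ℕ ys (λ z → ifLE P Q (ifEq (suc (a z)) P (x z)) + ifLE Q P (ifEq (suc (b z)) Q (y z)))
      ≡⟨ ℕSum.∑-⊕ ys _ _ ⟩
    ∑ℕ ys (λ z → ifLE P Q (ifEq (suc (a z)) P (x z))) + ∑ℕ ys (λ z → ifLE Q P (ifEq (suc (b z)) Q (y z)))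
      ≡⟨ cong₂ _+_ (ifLE-∑ ys P Q _) (ifLE-∑ ys Q P _) ⟩
    minCount P Q (∑ℕ ys (λ z → ifEq (suc (a z)) P (x z))) (∑ℕ ys (λ z → ifEq (suc (b z)) Q (y z))) ∎)
    where open ≡-Reasoning

  -- Arcs of the inner cycle

  -- Distances from v₀ to v_k and to u_k, and the number of v₀–v_k geodesics, for paths that stay
  -- on the arc of indices 0, 1, …, k.  For n ≥ 12 the distance in GP(n,2) is the shorter of the
  -- arcs k and n ∸ k, which distᵛ and geodᵛ record.
  arcᵛ : ℕ → ℕ
  arcᵛ 0             = 0
  arcᵛ 1             = 3
  arcᵛ (suc (suc k)) = suc (arcᵛ k)

  arcᵘ : ℕ → ℕ
  arcᵘ 0             = 1
  arcᵘ 1             = 2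
  arcᵘ (suc (suc k)) = suc (arcᵘ k)

  parity : ℕ → ℕ
  parity 0             = 0
  parity 1             = 1
  parity (suc (suc k)) = parity k

  arcGeodᵛ : ℕ → ℕ
  arcGeodᵛ 0             = 1
  arcGeodᵛ 1             = 1
  arcGeodᵛ (suc (suc k)) = arcGeodᵛ k + parity k

  distᵛ distᵘ geodᵛ geodᵘ : ℕ → ℕ → ℕ
  distᵛ a b = arcᵛ a ⊓ arcᵛ b
  distᵘ a b = arcᵘ a ⊓ arcᵘ b
  geodᵛ a b = minCount (arcᵛ a) (arcᵛ b) (arcGeodᵛ a) (arcGeodᵛ b)
  geodᵘ a b = minCount (arcᵘ a) (arcᵘ b) 1 1

  arcᵛ≤1+arcᵘ : ∀ k → arcᵛ k ≤ suc (arcᵘ k)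
  arcᵛ≤1+arcᵘ 0             = z≤n
  arcᵛ≤1+arcᵘ 1             = s≤s (s≤s (s≤s z≤n))
  arcᵛ≤1+arcᵘ (suc (suc k)) = s≤s (arcᵛ≤1+arcᵘ k)

  arcᵘ≤1+arcᵛ : ∀ k → arcᵘ k ≤ suc (arcᵛ k)
  arcᵘ≤1+arcᵛ 0             = s≤s z≤n
  arcᵘ≤1+arcᵛ 1             = s≤s (s≤s z≤n)
  arcᵘ≤1+arcᵛ (suc (suc k)) = s≤s (arcᵘ≤1+arcᵛ k)

  arcᵘ≤1+arcᵘ-suc : ∀ k → arcᵘ k ≤ suc (arcᵘ (suc k))
  arcᵘ≤1+arcᵘ-suc 0             = s≤s z≤n
  arcᵘ≤1+arcᵘ-suc 1             = s≤s (s≤s z≤n)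
  arcᵘ≤1+arcᵘ-suc (suc (suc k)) = s≤s (arcᵘ≤1+arcᵘ-suc k)

  arcᵘ-suc≤1+arcᵘ : ∀ k → arcᵘ (suc k) ≤ suc (arcᵘ k)
  arcᵘ-suc≤1+arcᵘ 0             = s≤s (s≤s z≤n)
  arcᵘ-suc≤1+arcᵘ 1             = s≤s (s≤s z≤n)
  arcᵘ-suc≤1+arcᵘ (suc (suc k)) = s≤s (arcᵘ-suc≤1+arcᵘ k)

  arcᵛ≤1+arcᵛ-2+ : ∀ k → arcᵛ k ≤ suc (arcᵛ (2 + k))
  arcᵛ≤1+arcᵛ-2+ k = m≤n⇒m≤1+n (n≤1+n (arcᵛ k))

  ifEq-2+ : ∀ a x → ifEq (suc (suc a)) a x ≡ 0
  ifEq-2+ a x = ifEq-no {suc (suc a)} {a} x (λ e → <-irrefl (sym e) (m≤n⇒m≤1+n ≤-refl))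

  ifEq-arcᵘ-arcᵛ : ∀ k → ifEq (suc (arcᵘ k)) (arcᵛ k) 1 ≡ parity k
  ifEq-arcᵘ-arcᵛ 0             = refl
  ifEq-arcᵘ-arcᵛ 1             = refl
  ifEq-arcᵘ-arcᵛ (suc (suc k)) = ifEq-arcᵘ-arcᵛ k

  arcGeodᵛ-even : ∀ k → parity k ≡ 0 → arcGeodᵛ k ≡ 1
  arcGeodᵛ-even 0             _ = refl
  arcGeodᵛ-even 1             ()
  arcGeodᵛ-even (suc (suc k)) e rewrite e = trans (+-identityʳ (arcGeodᵛ k)) (arcGeodᵛ-even k e)

  ifEq-arcᵘ-away : ∀ k x → ifEq (suc (arcᵘ (2 + k))) (arcᵘ (suc k)) x ≡ 0
  ifEq-arcᵘ-away 0             x = refl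
  ifEq-arcᵘ-away 1             x = refl
  ifEq-arcᵘ-away (suc (suc k)) x = ifEq-arcᵘ-away k x

  ifEq-arcᵘ-step : ∀ k → ifEq (suc (arcᵘ k)) (arcᵘ (suc k)) 1 + ifEq (suc (arcᵛ (suc k))) (arcᵘ (suc k)) 1 ≡ 1
  ifEq-arcᵘ-step 0             = refl
  ifEq-arcᵘ-step 1             = refl
  ifEq-arcᵘ-step (suc (suc k)) = ifEq-arcᵘ-step k

  ifEq-arcᵛ-arcᵘ-even : ∀ k x y → (parity (suc k) ≡ 0 → x ≡ y)
    → ifEq (suc (arcᵛ (suc k))) (arcᵘ (suc k)) x ≡ ifEq (suc (arcᵛ (suc k))) (arcᵘ (suc k)) y
  ifEq-arcᵛ-arcᵘ-even 0             x y x≡y = refl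
  ifEq-arcᵛ-arcᵘ-even 1             x y x≡y = x≡y refl
  ifEq-arcᵛ-arcᵘ-even (suc (suc k)) x y x≡y = ifEq-arcᵛ-arcᵘ-even k x y x≡y

  geodᵛ-interior : ∀ k K → geodᵛ (2 + k) (2 + K) ≡
      ifEq (suc (distᵛ (4 + k) K)) (distᵛ (2 + k) (2 + K)) (geodᵛ (4 + k) K)
    + (ifEq (suc (distᵛ k (4 + K))) (distᵛ (2 + k) (2 + K)) (geodᵛ k (4 + K))
    + (ifEq (suc (distᵘ (2 + k) (2 + K))) (distᵛ (2 + k) (2 + K)) (geodᵘ (2 + k) (2 + K)) + 0))
  geodᵛ-interior k K = trans (cong₂ (minCount (arcᵛ (2 + k)) (arcᵛ (2 + K))) left right)
    (minCount-∑ arcs (arcᵛ (2 + k)) (arcᵛ (2 + K)) proj₁ (proj₁ ∘ proj₂) (proj₁ ∘ proj₂ ∘ proj₂) (proj₂ ∘ proj₂ ∘ proj₂)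
      ((arcᵛ≤1+arcᵛ-2+ (2 + k) , ≤-refl) ∷ (≤-refl , arcᵛ≤1+arcᵛ-2+ (2 + K)) ∷ (arcᵛ≤1+arcᵘ (2 + k) , arcᵛ≤1+arcᵘ (2 + K)) ∷ []))
    where
    arcs : List (ℕ × ℕ × ℕ × ℕ)
    arcs = (arcᵛ (4 + k) , arcᵛ K , arcGeodᵛ (4 + k) , arcGeodᵛ K)
         ∷ (arcᵛ k , arcᵛ (4 + K) , arcGeodᵛ k , arcGeodᵛ (4 + K))
         ∷ (arcᵘ (2 + k) , arcᵘ (2 + K) , 1 , 1) ∷ []
    left : arcGeodᵛ (2 + k) ≡ ifEq (suc (arcᵛ (4 + k))) (arcᵛ (2 + k)) (arcGeodᵛ (4 + k))
             + (ifEq (suc (arcᵛ k)) (arcᵛ (2 + k)) (arcGeodᵛ k) + (ifEq (suc (arcᵘ (2 + k))) (arcᵛ (2 + k)) 1 + 0))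
    left = sym (cong₂ _+_ (ifEq-2+ (arcᵛ k) _)
                          (cong₂ _+_ (ifEq-yes {arcᵛ k} _ refl) (trans (+-identityʳ _) (ifEq-arcᵘ-arcᵛ k))))
    right : arcGeodᵛ (2 + K) ≡ ifEq (suc (arcᵛ K)) (arcᵛ (2 + K)) (arcGeodᵛ K)
             + (ifEq (suc (arcᵛ (4 + K))) (arcᵛ (2 + K)) (arcGeodᵛ (4 + K)) + (ifEq (suc (arcᵘ (2 + K))) (arcᵛ (2 + K)) 1 + 0))
    right = sym (cong₂ _+_ (ifEq-yes {arcᵛ K} _ refl)
                           (cong₂ _+_ (ifEq-2+ (arcᵛ K) _) (trans (+-identityʳ _) (ifEq-arcᵘ-arcᵛ K))))

  ifEq-arcᵘ-rec : ∀ k → ifEq (suc (arcᵘ k)) (arcᵘ (suc k)) 1 + ifEq (suc (arcᵛ (suc k))) (arcᵘ (suc k)) (arcGeodᵛ (suc k)) ≡ 1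
  ifEq-arcᵘ-rec k = trans (cong (ifEq (suc (arcᵘ k)) (arcᵘ (suc k)) 1 +_)
                                (ifEq-arcᵛ-arcᵘ-even k _ 1 (arcGeodᵛ-even (suc k))))
                          (ifEq-arcᵘ-step k)

  geodᵘ-interior : ∀ k K → geodᵘ (1 + k) (1 + K) ≡
      ifEq (suc (distᵘ (2 + k) K)) (distᵘ (1 + k) (1 + K)) (geodᵘ (2 + k) K)
    + (ifEq (suc (distᵘ k (2 + K))) (distᵘ (1 + k) (1 + K)) (geodᵘ k (2 + K))
    + (ifEq (suc (distᵛ (1 + k) (1 + K))) (distᵘ (1 + k) (1 + K)) (geodᵛ (1 + k) (1 + K)) + 0))
  geodᵘ-interior k K = trans (cong₂ (minCount (arcᵘ (1 + k)) (arcᵘ (1 + K))) left right)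
    (minCount-∑ arcs (arcᵘ (1 + k)) (arcᵘ (1 + K)) proj₁ (proj₁ ∘ proj₂) (proj₁ ∘ proj₂ ∘ proj₂) (proj₂ ∘ proj₂ ∘ proj₂)
      ((arcᵘ≤1+arcᵘ-suc (1 + k) , arcᵘ-suc≤1+arcᵘ K) ∷ (arcᵘ-suc≤1+arcᵘ k , arcᵘ≤1+arcᵘ-suc (1 + K))
        ∷ (arcᵘ≤1+arcᵛ (1 + k) , arcᵘ≤1+arcᵛ (1 + K)) ∷ []))
    where
    arcs : List (ℕ × ℕ × ℕ × ℕ)
    arcs = (arcᵘ (2 + k) , arcᵘ K , 1 , 1)
         ∷ (arcᵘ k , arcᵘ (2 + K) , 1 , 1)
         ∷ (arcᵛ (1 + k) , arcᵛ (1 + K) , arcGeodᵛ (1 + k) , arcGeodᵛ (1 + K)) ∷ []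
    left : 1 ≡ ifEq (suc (arcᵘ (2 + k))) (arcᵘ (1 + k)) 1
             + (ifEq (suc (arcᵘ k)) (arcᵘ (1 + k)) 1 + (ifEq (suc (arcᵛ (1 + k))) (arcᵘ (1 + k)) (arcGeodᵛ (1 + k)) + 0))
    left = sym (cong₂ _+_ (ifEq-arcᵘ-away k 1) (trans (cong (ifEq (suc (arcᵘ k)) (arcᵘ (1 + k)) 1 +_) (+-identityʳ _)) (ifEq-arcᵘ-rec k)))
    right : 1 ≡ ifEq (suc (arcᵘ K)) (arcᵘ (1 + K)) 1
             + (ifEq (suc (arcᵘ (2 + K))) (arcᵘ (1 + K)) 1 + (ifEq (suc (arcᵛ (1 + K))) (arcᵘ (1 + K)) (arcGeodᵛ (1 + K)) + 0))
    right = sym (trans (cong (ifEq (suc (arcᵘ K)) (arcᵘ (1 + K)) 1 +_) (cong₂ _+_ (ifEq-arcᵘ-away K 1) (+-identityʳ _)))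
                       (ifEq-arcᵘ-rec K))

  arcᵛ≡0⇒0 : ∀ k → arcᵛ k ≡ 0 → k ≡ 0
  arcᵛ≡0⇒0 0             _  = refl
  arcᵛ≡0⇒0 1             ()
  arcᵛ≡0⇒0 (suc (suc k)) ()

  1≤arcᵘ : ∀ k → 1 ≤ arcᵘ k
  1≤arcᵘ 0             = s≤s z≤n
  1≤arcᵘ 1             = s≤s z≤n
  1≤arcᵘ (suc (suc k)) = s≤s z≤n

  1≤arcGeodᵛ : ∀ k → 1 ≤ arcGeodᵛ k
  1≤arcGeodᵛ 0             = s≤s z≤n
  1≤arcGeodᵛ 1             = s≤s z≤n
  1≤arcGeodᵛ (suc (suc k)) = ≤-trans (1≤arcGeodᵛ k) (m≤m+n (arcGeodᵛ k) (parity k))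

  arcᵛ≤3+ : ∀ k → arcᵛ k ≤ 3 + k
  arcᵛ≤3+ 0             = z≤n
  arcᵛ≤3+ 1             = ≤-lit
  arcᵛ≤3+ (suc (suc k)) = s≤s (≤-trans (arcᵛ≤3+ k) (n≤1+n _))

  1≤arcᵛ : ∀ k → 1 ≤ k → 1 ≤ arcᵛ k
  1≤arcᵛ 1             _ = s≤s z≤n
  1≤arcᵛ (suc (suc k)) _ = s≤s z≤n

  parity≤1 : ∀ k → parity k ≤ 1
  parity≤1 0             = z≤n
  parity≤1 1             = ≤-refl
  parity≤1 (suc (suc k)) = parity≤1 k

  parity-cases : ∀ k → parity k ≡ 0 ⊎ parity k ≡ 1
  parity-cases 0             = inj₁ refl
  parity-cases 1             = inj₂ refl
  parity-cases (suc (suc k)) = parity-cases k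

  arcᵛ-double : ∀ k → arcᵛ k + arcᵛ k ≡ k + 5 * parity k
  arcᵛ-double 0             = refl
  arcᵛ-double 1             = refl
  arcᵛ-double (suc (suc k)) = cong suc (trans (+-suc (arcᵛ k) (arcᵛ k)) (cong suc (arcᵛ-double k)))

  k≤arcᵛ-double : ∀ k → k ≤ arcᵛ k + arcᵛ k
  k≤arcᵛ-double k = subst (k ≤_) (sym (arcᵛ-double k)) (m≤m+n k _)

  arcᵛ-double≤5+ : ∀ k → arcᵛ k + arcᵛ k ≤ k + 5
  arcᵛ-double≤5+ k = subst (_≤ k + 5) (sym (arcᵛ-double k)) (+-monoʳ-≤ k (*-monoʳ-≤ 5 (parity≤1 k)))

  arcᵛ-+ : ∀ a b → arcᵛ (a + b) + 5 * (parity a * parity b) ≡ arcᵛ a + arcᵛ b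
  arcᵛ-+ 0             b = +-identityʳ (arcᵛ b)
  arcᵛ-+ 1             b = trans (cong (λ z → arcᵛ (1 + b) + 5 * z) (+-identityʳ (parity b))) (odd b)
    where
    odd : ∀ b → arcᵛ (1 + b) + 5 * parity b ≡ 3 + arcᵛ b
    odd 0             = refl
    odd 1             = refl
    odd (suc (suc b)) = cong suc (odd b)
  arcᵛ-+ (suc (suc a)) b = cong suc (arcᵛ-+ a b)

  arcᵛ<arcᵛ-+-+arcᵛ : ∀ a b → 1 ≤ b → suc (arcᵛ a) ≤ arcᵛ (a + b) + arcᵛ b
  arcᵛ<arcᵛ-+-+arcᵛ 0             b 1≤b = ≤-trans (1≤arcᵛ b 1≤b) (m≤n+m (arcᵛ b) (arcᵛ b))
  arcᵛ<arcᵛ-+-+arcᵛ 1             b 1≤b = four b 1≤b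
    where
    four : ∀ b → 1 ≤ b → 4 ≤ arcᵛ (1 + b) + arcᵛ b
    four 1                   _ = ≤-refl
    four 2                   _ = ≤-lit
    four (suc (suc (suc b))) _ = ≤-trans (four (suc b) (s≤s z≤n)) (+-mono-≤ (n≤1+n (arcᵛ (2 + b))) (n≤1+n (arcᵛ (1 + b))))
  arcᵛ<arcᵛ-+-+arcᵛ (suc (suc a)) b 1≤b = s≤s (arcᵛ<arcᵛ-+-+arcᵛ a b 1≤b)

  parity-twice : ∀ q → parity (twice q) ≡ 0
  parity-twice zero    = refl
  parity-twice (suc q) = parity-twice q

  parity-1+twice : ∀ q → parity (suc (twice q)) ≡ 1
  parity-1+twice zero    = refl
  parity-1+twice (suc q) = parity-1+twice q

  arcGeodᵛ-twice : ∀ q → arcGeodᵛ (twice q) ≡ 1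
  arcGeodᵛ-twice q = arcGeodᵛ-even (twice q) (parity-twice q)

  arcGeodᵛ-1+twice : ∀ q → arcGeodᵛ (suc (twice q)) ≡ suc q
  arcGeodᵛ-1+twice zero    = refl
  arcGeodᵛ-1+twice (suc q) = trans (cong₂ _+_ (arcGeodᵛ-1+twice q) (parity-1+twice q)) (+-comm (suc q) 1)

  arcᵛ-twice : ∀ r → arcᵛ (twice r) ≡ r
  arcᵛ-twice zero    = refl
  arcᵛ-twice (suc r) = cong suc (arcᵛ-twice r)

  arcᵛ-1+twice : ∀ r → arcᵛ (suc (twice r)) ≡ 3 + r
  arcᵛ-1+twice zero    = refl
  arcᵛ-1+twice (suc r) = cong suc (arcᵛ-1+twice r)

  arcᵛ-+twice : ∀ c r → arcᵛ (c + twice r) ≡ arcᵛ c + r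
  arcᵛ-+twice 0             r = arcᵛ-twice r
  arcᵛ-+twice 1             r = arcᵛ-1+twice r
  arcᵛ-+twice (suc (suc c)) r = cong suc (arcᵛ-+twice c r)

  parity-+twice : ∀ c r → parity (c + twice r) ≡ parity c
  parity-+twice 0             r = parity-twice r
  parity-+twice 1             r = parity-1+twice r
  parity-+twice (suc (suc c)) r = parity-+twice c r

  arcGeodᵛ-+twice : ∀ c r → arcGeodᵛ (c + twice r) ≡ arcGeodᵛ c + parity c * r
  arcGeodᵛ-+twice 0             r = arcGeodᵛ-twice r
  arcGeodᵛ-+twice 1             r = trans (arcGeodᵛ-1+twice r) (cong suc (sym (+-identityʳ r)))
  arcGeodᵛ-+twice (suc (suc c)) r = begin
    arcGeodᵛ (c + twice r) + parity (c + twice r)          ≡⟨ cong₂ _+_ (arcGeodᵛ-+twice c r) (parity-+twice c r) ⟩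
    arcGeodᵛ c + parity c * r + parity c                   ≡⟨ swap (arcGeodᵛ c) (parity c * r) (parity c) ⟩
    arcGeodᵛ c + parity c + parity c * r                   ∎
    where
    open ≡-Reasoning
    swap : ∀ x y z → x + y + z ≡ x + z + y
    swap = solve-∀

  -- Geodesics through an intermediate inner vertex

  -- Geodesics v_{a+b} → v_b → v₀ along one arc: the two pieces concatenate to a geodesic unless
  -- a and b are both odd, when they are 5 longer than arcᵛ (a + b) (see arcᵛ-+).
  splitGeod : ℕ → ℕ → ℕ
  splitGeod a b = ifLE (parity a + parity b) 1 (arcGeodᵛ a * arcGeodᵛ b)

  splitGeodΔ : ℕ → ℕ → ℕ
  splitGeodΔ a b = ifLE (parity a + parity b) 1 (parity b)

  splitGeod-+2 : ∀ a b → splitGeod a (2 + b) ≡ splitGeod a b + splitGeodΔ a b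
  splitGeod-+2 a b with parity-cases a | parity-cases b
  ... | inj₁ pa | inj₁ pb rewrite pa | pb = trans (cong (arcGeodᵛ a *_) (+-identityʳ (arcGeodᵛ b))) (sym (+-identityʳ _))
  ... | inj₁ pa | inj₂ pb rewrite pa | pb | arcGeodᵛ-even a pa = *-distribˡ-+ 1 (arcGeodᵛ b) 1
  ... | inj₂ pa | inj₁ pb rewrite pa | pb = trans (cong (arcGeodᵛ a *_) (+-identityʳ (arcGeodᵛ b))) (sym (+-identityʳ _))
  ... | inj₂ pa | inj₂ pb rewrite pa | pb = refl

  diagonalΔ-rec : ∀ s → 1 ≤ s → ℕSum.diagonal splitGeodΔ (2 + s) ≡ ℕSum.diagonal splitGeodΔ s + splitGeodΔ s 2 + splitGeodΔ (suc s) 1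
  diagonalΔ-rec s 1≤s = ℕSum.diagonal-+2 s splitGeodΔ 1≤s

  diagonal-splitGeod-rec : ∀ s → 1 ≤ s → ℕSum.diagonal splitGeod (2 + s)
    ≡ (ℕSum.diagonal splitGeod s + ℕSum.diagonal splitGeodΔ s) + splitGeod s 2 + splitGeod (suc s) 1
  diagonal-splitGeod-rec s 1≤s = trans (ℕSum.diagonal-+2 s splitGeod 1≤s) (cong (λ z → z + splitGeod s 2 + splitGeod (suc s) 1)
    (trans (ℕSum.∑-congᴵ 1 (s ∸ 1) (λ a _ _ → splitGeod-+2 a (s ∸ a))) (ℕSum.∑-⊕ (interval 1 (s ∸ 1)) _ _)))

  diagonalΔ-even : ∀ q → ℕSum.diagonal splitGeodΔ (2 + twice q) ≡ 0
  diagonalΔ-even zero    = refl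
  diagonalΔ-even (suc q) rewrite diagonalΔ-rec (2 + twice q) (s≤s z≤n) | diagonalΔ-even q | parity-twice q | parity-1+twice q = refl

  diagonalΔ-odd : ∀ q → ℕSum.diagonal splitGeodΔ (suc (twice q)) ≡ q
  diagonalΔ-odd zero    = refl
  diagonalΔ-odd (suc q) rewrite diagonalΔ-rec (suc (twice q)) (s≤s z≤n) | diagonalΔ-odd q | parity-twice q | parity-1+twice q =
    trans (cong (_+ 1) (+-identityʳ q)) (+-comm q 1)

  diagonal-splitGeod-even : ∀ q → ℕSum.diagonal splitGeod (2 + twice q) ≡ q
  diagonal-splitGeod-even zero    = refl
  diagonal-splitGeod-even (suc q)
    rewrite diagonal-splitGeod-rec (2 + twice q) (s≤s z≤n) | diagonal-splitGeod-even q | diagonalΔ-even q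
          | parity-twice q | parity-1+twice q | arcGeodᵛ-twice q = arith q
    where
    arith : ∀ q → q + 0 + 1 * 1 + 0 ≡ suc q
    arith = solve-∀

  diagonal-splitGeod-odd : ∀ q → ℕSum.diagonal splitGeod (suc (twice q)) ≡ q * suc q
  diagonal-splitGeod-odd zero    = refl
  diagonal-splitGeod-odd (suc q)
    rewrite diagonal-splitGeod-rec (suc (twice q)) (s≤s z≤n) | diagonal-splitGeod-odd q | diagonalΔ-odd q
          | parity-twice q | parity-1+twice q | arcGeodᵛ-1+twice q | arcGeodᵛ-twice q = arith q
    where
    arith : ∀ q → q * suc q + q + suc q * 1 + 1 * 1 ≡ suc q * suc (suc q)
    arith = solve-∀

  diagonal-splitGeod : ∀ s → ℕSum.diagonal splitGeod s ≡ ⌊ s ∸ 1 /2⌋ * arcGeodᵛ s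
  diagonal-splitGeod s with twice-or-1+twice s
  ... | zero  , inj₁ refl = refl
  ... | suc q , inj₁ refl = trans (diagonal-splitGeod-even q)
                                 (sym (trans (cong₂ _*_ (⌊1+twice/2⌋ q) (arcGeodᵛ-twice (suc q))) (*-identityʳ q)))
  ... | q     , inj₂ refl = trans (diagonal-splitGeod-odd q) (sym (cong₂ _*_ (⌊twice/2⌋ q) (arcGeodᵛ-1+twice q)))

  ∑-⌊∸1/2⌋ : ∀ j → ∑ℕ (interval 2 (twice j)) (λ s → ⌊ s ∸ 1 /2⌋) ≡ j * j
  ∑-⌊∸1/2⌋ zero    = refl
  ∑-⌊∸1/2⌋ (suc j) = begin
    ∑ℕ (interval 2 (2 + twice j)) φ                       ≡⟨ ℕSum.∑-snoc 2 (suc (twice j)) φ ⟩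
    ∑ℕ (interval 2 (1 + twice j)) φ + φ (3 + twice j)     ≡⟨ cong (_+ φ (3 + twice j)) (ℕSum.∑-snoc 2 (twice j) φ) ⟩
    ∑ℕ (interval 2 (twice j)) φ + φ (2 + twice j) + φ (3 + twice j)
      ≡⟨ cong₂ (λ x y → x + φ (2 + twice j) + y) (∑-⌊∸1/2⌋ j) (cong suc (⌊twice/2⌋ j)) ⟩
    j * j + φ (2 + twice j) + suc j                       ≡⟨ cong (λ z → j * j + z + suc j) (⌊1+twice/2⌋ j) ⟩
    j * j + j + suc j                                     ≡⟨ arith j ⟩
    suc j * suc j                                         ∎
    where
    open ≡-Reasoning
    φ : ℕ → ℕ
    φ s = ⌊ s ∸ 1 /2⌋
    arith : ∀ j → j * j + j + suc j ≡ suc j * suc j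
    arith = solve-∀

  ∑-⌊∸1/2⌋-odd : ∀ j → ∑ℕ (interval 2 (suc (twice j))) (λ s → ⌊ s ∸ 1 /2⌋) ≡ j * j + j
  ∑-⌊∸1/2⌋-odd j = trans (ℕSum.∑-snoc 2 (twice j) (λ s → ⌊ s ∸ 1 /2⌋)) (cong₂ _+_ (∑-⌊∸1/2⌋ j) (⌊1+twice/2⌋ j))

  -- Distances and geodesic counts to v₀

  module TargetV₀ (m : ℕ) where

    n : ℕ
    n = 12 + m

    Eᵛ Eᵘ Nᵛ Nᵘ : ℕ → ℕ
    Eᵛ k = distᵛ k (n ∸ k)
    Eᵘ k = distᵘ k (n ∸ k)
    Nᵛ k = geodᵛ k (n ∸ k)
    Nᵘ k = geodᵘ k (n ∸ k)

    BellmanᵛAt LipschitzᵛAt BellmanᵘAt LipschitzᵘAt : ℕ → ℕ → ℕ → Set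
    BellmanᵛAt k a₁ a₂ = Nᵛ k ≡ ifEq (suc (Eᵛ a₁)) (Eᵛ k) (Nᵛ a₁)
                                + (ifEq (suc (Eᵛ a₂)) (Eᵛ k) (Nᵛ a₂) + (ifEq (suc (Eᵘ k)) (Eᵛ k) (Nᵘ k) + 0))
    LipschitzᵛAt k a₁ a₂ = (Eᵛ k ≤ suc (Eᵛ a₁)) × (Eᵛ k ≤ suc (Eᵛ a₂)) × (Eᵛ k ≤ suc (Eᵘ k))
    BellmanᵘAt k b₁ b₂ = Nᵘ k ≡ ifEq (suc (Eᵘ b₁)) (Eᵘ k) (Nᵘ b₁)
                                + (ifEq (suc (Eᵘ b₂)) (Eᵘ k) (Nᵘ b₂) + (ifEq (suc (Eᵛ k)) (Eᵘ k) (Nᵛ k) + 0))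
    LipschitzᵘAt k b₁ b₂ = (Eᵘ k ≤ suc (Eᵘ b₁)) × (Eᵘ k ≤ suc (Eᵘ b₂)) × (Eᵘ k ≤ suc (Eᵛ k))

    module Interiorᵛ (k : ℕ) (5+k≤n : 5 + k ≤ n) where
      K : ℕ
      K = n ∸ (4 + k)

      bellman : BellmanᵛAt (2 + k) (4 + k) k
      bellman rewrite ∸-split 2 (2 + k) n (≤-trans (n≤1+n _) 5+k≤n) | ∸-split 4 k n (≤-trans (n≤1+n _) 5+k≤n) = geodᵛ-interior k K

      lipschitz : LipschitzᵛAt (2 + k) (4 + k) k
      lipschitz rewrite ∸-split 2 (2 + k) n (≤-trans (n≤1+n _) 5+k≤n) | ∸-split 4 k n (≤-trans (n≤1+n _) 5+k≤n) =
        ⊓-mono-≤ (arcᵛ≤1+arcᵛ-2+ (2 + k)) ≤-refl , ⊓-mono-≤ ≤-refl (arcᵛ≤1+arcᵛ-2+ (2 + K)) ,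
        ⊓-mono-≤ (arcᵛ≤1+arcᵘ (2 + k)) (arcᵛ≤1+arcᵘ (2 + K))

    module Interiorᵘ (k : ℕ) (3+k≤n : 3 + k ≤ n) where
      K : ℕ
      K = n ∸ (2 + k)

      bellman : BellmanᵘAt (1 + k) (2 + k) k
      bellman rewrite ∸-split 1 (1 + k) n (≤-trans (n≤1+n _) 3+k≤n) | ∸-split 2 k n (≤-trans (n≤1+n _) 3+k≤n) = geodᵘ-interior k K

      lipschitz : LipschitzᵘAt (1 + k) (2 + k) k
      lipschitz rewrite ∸-split 1 (1 + k) n (≤-trans (n≤1+n _) 3+k≤n) | ∸-split 2 k n (≤-trans (n≤1+n _) 3+k≤n) =
        ⊓-mono-≤ (arcᵘ≤1+arcᵘ-suc (1 + k)) (arcᵘ-suc≤1+arcᵘ K) , ⊓-mono-≤ (arcᵘ-suc≤1+arcᵘ k) (arcᵘ≤1+arcᵘ-suc (1 + K)) ,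
        ⊓-mono-≤ (arcᵘ≤1+arcᵛ (1 + k)) (arcᵘ≤1+arcᵛ (1 + K))

    -- Near index 0 the cycle neighbours wrap around, so these vertices are checked directly.
    Eᵛ-n-1 : Eᵛ (11 + m) ≡ 3
    Eᵛ-n-1 = cong (distᵛ (11 + m)) (m+n∸n≡m 1 m)
    Eᵛ-n-2 : Eᵛ (10 + m) ≡ 1
    Eᵛ-n-2 = cong (distᵛ (10 + m)) (m+n∸n≡m 2 m)
    Eᵛ-n-3 : Eᵛ (9 + m) ≡ 4
    Eᵛ-n-3 = trans (cong (distᵛ (9 + m)) (m+n∸n≡m 3 m)) (cong (4 +_) (⊓-zeroʳ (arcᵛ (suc m))))
    Eᵛ-n-4 : Eᵛ (8 + m) ≡ 2
    Eᵛ-n-4 = cong (distᵛ (8 + m)) (m+n∸n≡m 4 m)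
    Eᵘ-n-1 : Eᵘ (11 + m) ≡ 2
    Eᵘ-n-1 = cong (distᵘ (11 + m)) (m+n∸n≡m 1 m)
    Eᵘ-n-2 : Eᵘ (10 + m) ≡ 2
    Eᵘ-n-2 = cong (distᵘ (10 + m)) (m+n∸n≡m 2 m)
    Nᵛ-n-1 : Nᵛ (11 + m) ≡ 1
    Nᵛ-n-1 = cong (geodᵛ (11 + m)) (m+n∸n≡m 1 m)
    Nᵛ-n-2 : Nᵛ (10 + m) ≡ 1
    Nᵛ-n-2 = cong (geodᵛ (10 + m)) (m+n∸n≡m 2 m)
    Nᵘ-n-1 : Nᵘ (11 + m) ≡ 1
    Nᵘ-n-1 = cong (geodᵘ (11 + m)) (m+n∸n≡m 1 m)

    lipschitzᵛ-0 : LipschitzᵛAt 0 2 (10 + m)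
    lipschitzᵛ-0 = z≤n , z≤n , z≤n

    bellmanᵛ-1 : BellmanᵛAt 1 3 (11 + m)
    bellmanᵛ-1 rewrite Eᵛ-n-1 = refl

    lipschitzᵛ-1 : LipschitzᵛAt 1 3 (11 + m)
    lipschitzᵛ-1 rewrite Eᵛ-n-1 = ≤-lit , ≤-lit , ≤-lit

    bellmanᵛ-n-2 : BellmanᵛAt (10 + m) 0 (8 + m)
    bellmanᵛ-n-2 rewrite Eᵛ-n-2 | Eᵛ-n-4 | Eᵘ-n-2 = Nᵛ-n-2

    lipschitzᵛ-n-2 : LipschitzᵛAt (10 + m) 0 (8 + m)
    lipschitzᵛ-n-2 rewrite Eᵛ-n-2 | Eᵛ-n-4 | Eᵘ-n-2 = ≤-lit , ≤-lit , ≤-lit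

    bellmanᵛ-n-1 : BellmanᵛAt (11 + m) 1 (9 + m)
    bellmanᵛ-n-1 rewrite Eᵛ-n-1 | Eᵛ-n-3 | Eᵘ-n-1 | Nᵘ-n-1 = Nᵛ-n-1

    lipschitzᵛ-n-1 : LipschitzᵛAt (11 + m) 1 (9 + m)
    lipschitzᵛ-n-1 rewrite Eᵛ-n-1 | Eᵛ-n-3 | Eᵘ-n-1 = ≤-lit , ≤-lit , ≤-lit

    bellmanᵘ-0 : BellmanᵘAt 0 1 (11 + m)
    bellmanᵘ-0 rewrite Eᵘ-n-1 = refl

    lipschitzᵘ-0 : LipschitzᵘAt 0 1 (11 + m)
    lipschitzᵘ-0 rewrite Eᵘ-n-1 = ≤-lit , ≤-lit , ≤-lit

    bellmanᵘ-n-1 : BellmanᵘAt (11 + m) 0 (10 + m)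
    bellmanᵘ-n-1 rewrite Eᵘ-n-1 | Eᵘ-n-2 | Eᵛ-n-1 = Nᵘ-n-1

    lipschitzᵘ-n-1 : LipschitzᵘAt (11 + m) 0 (10 + m)
    lipschitzᵘ-n-1 rewrite Eᵘ-n-1 | Eᵘ-n-2 | Eᵛ-n-1 = ≤-lit , ≤-lit , ≤-lit

    %n-below : ∀ x y → y ≡ x → x < n → y % n ≡ x
    %n-below x y refl x<n = m<n⇒m%n≡m x<n

    %n-wrap : ∀ x y → y ≡ x + n → x < n → y % n ≡ x
    %n-wrap x y refl x<n = trans ([m+n]%n≡m%n x n) (m<n⇒m%n≡m x<n)

    Neighbourᵛ Neighbourᵘ : ℕ → Set
    Neighbourᵛ k = (0 < k → BellmanᵛAt k ((k + 2) % n) ((k + (n ∸ 2)) % n)) × LipschitzᵛAt k ((k + 2) % n) ((k + (n ∸ 2)) % n)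
    Neighbourᵘ k = BellmanᵘAt k ((k + 1) % n) ((k + (n ∸ 1)) % n) × LipschitzᵘAt k ((k + 1) % n) ((k + (n ∸ 1)) % n)

    neighbourᵛ-at : ∀ k {a₁ a₂} → (k + 2) % n ≡ a₁ → (k + (n ∸ 2)) % n ≡ a₂
                  → (0 < k → BellmanᵛAt k a₁ a₂) → LipschitzᵛAt k a₁ a₂ → Neighbourᵛ k
    neighbourᵛ-at k refl refl bellman lipschitz = bellman , lipschitz

    neighbourᵘ-at : ∀ k {b₁ b₂} → (k + 1) % n ≡ b₁ → (k + (n ∸ 1)) % n ≡ b₂
                  → BellmanᵘAt k b₁ b₂ → LipschitzᵘAt k b₁ b₂ → Neighbourᵘ k
    neighbourᵘ-at k refl refl bellman lipschitz = bellman , lipschitz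

    neighbourᵛ : ∀ k → k < n → Neighbourᵛ k
    neighbourᵛ 0 _ = neighbourᵛ-at 0 (%n-below 2 2 refl ≤-lit) (%n-below (10 + m) (10 + m) refl (n≤1+n _))
      (λ ()) lipschitzᵛ-0
    neighbourᵛ 1 _ = neighbourᵛ-at 1 (%n-below 3 3 refl ≤-lit) (%n-below (11 + m) (11 + m) refl ≤-refl)
      (λ _ → bellmanᵛ-1) lipschitzᵛ-1
    neighbourᵛ (suc (suc k)) k<n with 5 + k ≤? n
    ... | yes 5+k≤n = neighbourᵛ-at (2 + k)
      (%n-below (4 + k) (2 + k + 2) (cong (2 +_) (+-comm k 2)) 5+k≤n)
      (%n-wrap k (2 + k + (10 + m)) (wrap k m) (≤-trans (n≤1+n _) (≤-trans (n≤1+n _) k<n)))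
      (λ _ → Interiorᵛ.bellman k 5+k≤n) (Interiorᵛ.lipschitz k 5+k≤n)
      where
      wrap : ∀ k m → 2 + k + (10 + m) ≡ k + (12 + m)
      wrap = solve-∀
    ... | no 5+k≰n with k ≟ 8 + m | k ≟ 9 + m
    ...   | yes refl | _ = neighbourᵛ-at (10 + m)
      (%n-wrap 0 (10 + m + 2) (+-comm (10 + m) 2) ≤-lit) (%n-wrap (8 + m) (10 + m + (10 + m)) (wrap m) (+-monoˡ-≤ m ≤-lit))
      (λ _ → bellmanᵛ-n-2) lipschitzᵛ-n-2
      where
      wrap : ∀ m → 10 + m + (10 + m) ≡ 8 + m + (12 + m)
      wrap = solve-∀
    ...   | no _     | yes refl = neighbourᵛ-at (11 + m)
      (%n-wrap 1 (11 + m + 2) (+-comm (11 + m) 2) ≤-lit) (%n-wrap (9 + m) (11 + m + (10 + m)) (wrap m) (+-monoˡ-≤ m ≤-lit))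
      (λ _ → bellmanᵛ-n-1) lipschitzᵛ-n-1
      where
      wrap : ∀ m → 11 + m + (10 + m) ≡ 9 + m + (12 + m)
      wrap = solve-∀
    ...   | no k≢8+m | no k≢9+m = ⊥-elim (5+k≰n (≤∧≢⇒< (≤∧≢⇒< k<n (k≢9+m ∘ cong (_∸ 3))) (k≢8+m ∘ cong (_∸ 4))))

    neighbourᵘ : ∀ k → k < n → Neighbourᵘ k
    neighbourᵘ 0 _ = neighbourᵘ-at 0 (%n-below 1 1 refl ≤-lit) (%n-below (11 + m) (11 + m) refl ≤-refl)
      bellmanᵘ-0 lipschitzᵘ-0
    neighbourᵘ (suc k) k<n with 3 + k ≤? n
    ... | yes 3+k≤n = neighbourᵘ-at (1 + k)
      (%n-below (2 + k) (1 + k + 1) (cong (1 +_) (+-comm k 1)) 3+k≤n)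
      (%n-wrap k (1 + k + (11 + m)) (wrap k m) (≤-trans (n≤1+n _) k<n))
      (Interiorᵘ.bellman k 3+k≤n) (Interiorᵘ.lipschitz k 3+k≤n)
      where
      wrap : ∀ k m → 1 + k + (11 + m) ≡ k + (12 + m)
      wrap = solve-∀
    ... | no 3+k≰n with k ≟ 10 + m
    ...   | yes refl = neighbourᵘ-at (11 + m)
      (%n-wrap 0 (11 + m + 1) (+-comm (11 + m) 1) ≤-lit) (%n-wrap (10 + m) (11 + m + (11 + m)) (wrap m) (+-monoˡ-≤ m ≤-lit))
      bellmanᵘ-n-1 lipschitzᵘ-n-1
      where
      wrap : ∀ m → 11 + m + (11 + m) ≡ 10 + m + (12 + m)
      wrap = solve-∀
    ...   | no k≢10+m = ⊥-elim (3+k≰n (≤∧≢⇒< k<n (k≢10+m ∘ cong (_∸ 2))))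

    open Rotation n using (toℕ-shift)

    E N : Vertex n → ℕ
    E (u i) = Eᵘ (toℕ i)
    E (v i) = Eᵛ (toℕ i)
    N (u i) = Nᵘ (toℕ i)
    N (v i) = Nᵛ (toℕ i)

    E≡0⇒v₀ : ∀ s → E s ≡ 0 → s ≡ v₀ n
    E≡0⇒v₀ (u i) Es≡0 = ⊥-elim (<-irrefl (sym Es≡0) (⊓-mono-≤ (1≤arcᵘ (toℕ i)) (1≤arcᵘ (n ∸ toℕ i))))
    E≡0⇒v₀ (v i) Es≡0 with ⊓-sel (arcᵛ (toℕ i)) (arcᵛ (n ∸ toℕ i))
    ... | inj₁ ⊓≡l = cong v (toℕ-injective (arcᵛ≡0⇒0 (toℕ i) (trans (sym ⊓≡l) Es≡0)))
    ... | inj₂ ⊓≡r = ⊥-elim (<-irrefl refl (<-≤-trans (toℕ<n i) (m∸n≡0⇒m≤n (arcᵛ≡0⇒0 (n ∸ toℕ i) (trans (sym ⊓≡r) Es≡0)))))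

    E-lipschitz : ∀ s → All (λ y → E s ≤ suc (E y)) (nbrs n s)
    E-lipschitz (u i) with proj₂ (neighbourᵘ (toℕ i) (toℕ<n i))
    ... | l₁ , l₂ , l₃ = subst (λ z → Eᵘ (toℕ i) ≤ suc (Eᵘ z)) (sym (toℕ-shift 1 i)) l₁
                       ∷ subst (λ z → Eᵘ (toℕ i) ≤ suc (Eᵘ z)) (sym (toℕ-shift (n ∸ 1) i)) l₂ ∷ l₃ ∷ []
    E-lipschitz (v i) with proj₂ (neighbourᵛ (toℕ i) (toℕ<n i))
    ... | l₁ , l₂ , l₃ = subst (λ z → Eᵛ (toℕ i) ≤ suc (Eᵛ z)) (sym (toℕ-shift 2 i)) l₁
                       ∷ subst (λ z → Eᵛ (toℕ i) ≤ suc (Eᵛ z)) (sym (toℕ-shift (n ∸ 2) i)) l₂ ∷ l₃ ∷ []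

    N-rec : ∀ s → s ≢ v₀ n → N s ≡ ∑ℕ (nbrs n s) (λ y → ifEq (suc (E y)) (E s) (N y))
    N-rec (u i) _ = subst₂ (BellmanᵘAt (toℕ i)) (sym (toℕ-shift 1 i)) (sym (toℕ-shift (n ∸ 1) i))
                           (proj₁ (neighbourᵘ (toℕ i) (toℕ<n i)))
    N-rec (v i) s≢v₀ = subst₂ (BellmanᵛAt (toℕ i)) (sym (toℕ-shift 2 i)) (sym (toℕ-shift (n ∸ 2) i))
                              (proj₁ (neighbourᵛ (toℕ i) (toℕ<n i)) 0<i)
      where
      0<i : 0 < toℕ i
      0<i with toℕ i in eq
      ... | zero  = ⊥-elim (s≢v₀ (cong v (toℕ-injective eq)))
      ... | suc _ = s≤s z≤n

    open Certificate n (v₀ n) E N E≡0⇒v₀ refl E-lipschitz refl N-rec public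

  -- Fractions

  frac-≃ : ∀ x d → ℚ.toℚᵘ (frac x (suc d)) ℚᵘ.≃ ℚᵘ.mkℚᵘ (ℤ.+ x) d
  frac-≃ x d = ℚP.toℚᵘ-fromℚᵘ (ℚᵘ.mkℚᵘ (ℤ.+ x) d)

  frac≡/ : ∀ x e (z : ℤ) d → ℤ.+ x ℤ.* ℤ.+ suc d ≡ z ℤ.* ℤ.+ suc e → frac x (suc e) ≡ z ℚ./ suc d
  frac≡/ x e z d eq = ℚP.toℚᵘ-injective
    (ℚᵘP.≃-trans (frac-≃ x e) (ℚᵘP.≃-trans (ℚᵘ.*≡* eq) (ℚᵘP.≃-sym (ℚP.toℚᵘ-fromℚᵘ (ℚᵘ.mkℚᵘ z d)))))

  frac-cross : ∀ a b {d e} → 1 ≤ d → 1 ≤ e → a * e ≡ b * d → frac a d ≡ frac b e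
  frac-cross a b {suc d} {suc e} _ _ eq = frac≡/ a d (ℤ.+ b) e
    (trans (sym (ℤP.pos-* a (suc e))) (trans (cong ℤ.+_ eq) (ℤP.pos-* b (suc d))))

  frac-+frac : ∀ a d b e → frac a (suc d) ℚ.+ frac b (suc e) ≡ frac (a * suc e + b * suc d) (suc d * suc e)
  frac-+frac a d b e = ℚP.toℚᵘ-injective (begin
    ℚ.toℚᵘ (frac a (suc d) ℚ.+ frac b (suc e))                    ≈⟨ ℚP.toℚᵘ-homo-+ (frac a (suc d)) (frac b (suc e)) ⟩
    ℚ.toℚᵘ (frac a (suc d)) ℚᵘ.+ ℚ.toℚᵘ (frac b (suc e))          ≈⟨ ℚᵘP.+-cong (frac-≃ a d) (frac-≃ b e) ⟩
    ℚᵘ.mkℚᵘ (ℤ.+ a) d ℚᵘ.+ ℚᵘ.mkℚᵘ (ℤ.+ b) e                      ≡⟨ cong (λ z → ℚᵘ.mkℚᵘ z (e + d * suc e)) numerator ⟩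
    ℚᵘ.mkℚᵘ (ℤ.+ (a * suc e + b * suc d)) (e + d * suc e)          ≈⟨ ℚᵘP.≃-sym (frac-≃ (a * suc e + b * suc d) (e + d * suc e)) ⟩
    ℚ.toℚᵘ (frac (a * suc e + b * suc d) (suc d * suc e))         ∎)
    where
    open ℚᵘP.≃-Reasoning
    numerator : ℤ.+ a ℤ.* ℤ.+ suc e ℤ.+ ℤ.+ b ℤ.* ℤ.+ suc d ≡ ℤ.+ (a * suc e + b * suc d)
    numerator = sym (trans (ℤP.pos-+ (a * suc e) (b * suc d)) (cong₂ ℤ._+_ (ℤP.pos-* a (suc e)) (ℤP.pos-* b (suc d))))

  frac-0 : ∀ {d} → 1 ≤ d → frac 0 d ≡ 0ℚ
  frac-0 1≤d = frac-cross 0 0 1≤d ≤-refl refl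

  frac-+ : ∀ x y {d} → 1 ≤ d → frac x d ℚ.+ frac y d ≡ frac (x + y) d
  frac-+ x y {suc d} 1≤d = trans (frac-+frac x d y d)
    (frac-cross (x * suc d + y * suc d) (x + y) (*-mono-≤ 1≤d 1≤d) 1≤d (cancel x y (suc d)))
    where
    cancel : ∀ x y c → (x * c + y * c) * c ≡ (x + y) * (c * c)
    cancel = solve-∀

  frac-*-cancel : ∀ x {c} → 1 ≤ c → frac (x * c) c ≡ frac x 1
  frac-*-cancel x {c} 1≤c = frac-cross (x * c) x 1≤c ≤-refl (*-identityʳ (x * c))

  ∑-frac : {A : Set} (xs : List A) (h : A → ℕ) {d : ℕ} → 1 ≤ d → ∑ℚ xs (λ a → frac (h a) d) ≡ frac (∑ℕ xs h) d
  ∑-frac []       h 1≤d = sym (frac-0 1≤d)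
  ∑-frac (x ∷ xs) h {d} 1≤d = trans (cong (frac (h x) d ℚ.+_) (∑-frac xs h 1≤d)) (frac-+ (h x) (∑ℕ xs h) 1≤d)

  frac-int+frac : ∀ x y e → frac x 1 ℚ.+ frac y (suc e) ≡ frac (x * suc e + y) (suc e)
  frac-int+frac x y e = trans (frac-+frac x 0 y e)
    (cong₂ frac (cong (x * suc e +_) (*-identityʳ y)) (+-identityʳ (suc e)))

  frac≡/-sub : ∀ X e P Q d → X * suc d + Q * suc e ≡ P * suc e → frac X (suc e) ≡ (ℤ.+ P ℤ.- ℤ.+ Q) ℚ./ suc d
  frac≡/-sub X e P Q d eq = frac≡/ X e (ℤ.+ P ℤ.- ℤ.+ Q) d (begin
    ℤ.+ X ℤ.* ℤ.+ suc d                                             ≡⟨ sym (ℤP.pos-* X (suc d)) ⟩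
    ℤ.+ (X * suc d)                                                 ≡⟨ isolate (ℤ.+ (X * suc d)) (ℤ.+ (Q * suc e)) ⟩
    ℤ.+ (X * suc d) ℤ.+ ℤ.+ (Q * suc e) ℤ.- ℤ.+ (Q * suc e)         ≡⟨ cong (ℤ._- ℤ.+ (Q * suc e)) (sym (ℤP.pos-+ (X * suc d) (Q * suc e))) ⟩
    ℤ.+ (X * suc d + Q * suc e) ℤ.- ℤ.+ (Q * suc e)                 ≡⟨ cong₂ (λ x y → ℤ.+ x ℤ.- y) eq (ℤP.pos-* Q (suc e)) ⟩
    ℤ.+ (P * suc e) ℤ.- ℤ.+ Q ℤ.* ℤ.+ suc e                         ≡⟨ cong (ℤ._- ℤ.+ Q ℤ.* ℤ.+ suc e) (ℤP.pos-* P (suc e)) ⟩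
    ℤ.+ P ℤ.* ℤ.+ suc e ℤ.- ℤ.+ Q ℤ.* ℤ.+ suc e                     ≡⟨ factor (ℤ.+ P) (ℤ.+ Q) (ℤ.+ suc e) ⟩
    (ℤ.+ P ℤ.- ℤ.+ Q) ℤ.* ℤ.+ suc e                                 ∎)
    where
    open ≡-Reasoning
    isolate : ∀ (x y : ℤ) → x ≡ x ℤ.+ y ℤ.- y
    isolate = ℤSolver.solve-∀
    factor : ∀ (p q s : ℤ) → p ℤ.* s ℤ.- q ℤ.* s ≡ (p ℤ.- q) ℤ.* s
    factor = ℤSolver.solve-∀

  ℚ-+-pull : ∀ x y t z → x ℚ.+ (y ℚ.+ (t ℚ.+ z)) ≡ t ℚ.+ (x ℚ.+ (y ℚ.+ z))
  ℚ-+-pull x y t z = trans (cong (x ℚ.+_) (left-comm y t z)) (left-comm x t (y ℚ.+ z))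
    where
    left-comm : ∀ a b c → a ℚ.+ (b ℚ.+ c) ≡ b ℚ.+ (a ℚ.+ c)
    left-comm a b c = trans (sym (ℚP.+-assoc a b c)) (trans (cong (ℚ._+ c) (ℚP.+-comm a b)) (ℚP.+-assoc b a c))

  frac-int+frac+int : ∀ L Y e I → frac L 1 ℚ.+ (frac Y (suc e) ℚ.+ frac I 1) ≡ frac ((L + I) * suc e + Y) (suc e)
  frac-int+frac+int L Y e I = begin
    frac L 1 ℚ.+ (frac Y (suc e) ℚ.+ frac I 1)  ≡⟨ cong (frac L 1 ℚ.+_) (ℚP.+-comm (frac Y (suc e)) (frac I 1)) ⟩
    frac L 1 ℚ.+ (frac I 1 ℚ.+ frac Y (suc e))  ≡⟨ sym (ℚP.+-assoc (frac L 1) (frac I 1) (frac Y (suc e))) ⟩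
    (frac L 1 ℚ.+ frac I 1) ℚ.+ frac Y (suc e)  ≡⟨ cong (ℚ._+ frac Y (suc e)) (frac-+ L I ≤-refl) ⟩
    frac (L + I) 1 ℚ.+ frac Y (suc e)           ≡⟨ frac-int+frac (L + I) Y e ⟩
    frac ((L + I) * suc e + Y) (suc e)          ∎
    where open ≡-Reasoning

  reorder : ∀ a b c → ℤ.+ (a + c) ℤ.- ℤ.+ b ≡ ℤ.+ a ℤ.- ℤ.+ b ℤ.+ ℤ.+ c
  reorder a b c = trans (cong (ℤ._- ℤ.+ b) (ℤP.pos-+ a c)) (swap (ℤ.+ a) (ℤ.+ b) (ℤ.+ c))
    where
    swap : ∀ (x y z : ℤ) → x ℤ.+ z ℤ.- y ≡ x ℤ.- y ℤ.+ z
    swap = ℤSolver.solve-∀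

  reorder₄ : ∀ a b c e → ℤ.+ (a + c + e) ℤ.- ℤ.+ b ≡ ℤ.+ a ℤ.- ℤ.+ b ℤ.+ ℤ.+ c ℤ.+ ℤ.+ e
  reorder₄ a b c e = trans (cong (ℤ._- ℤ.+ b) (trans (ℤP.pos-+ (a + c) e) (cong (ℤ._+ ℤ.+ e) (ℤP.pos-+ a c))))
                           (swap (ℤ.+ a) (ℤ.+ b) (ℤ.+ c) (ℤ.+ e))
    where
    swap : ∀ (x y z w : ℤ) → x ℤ.+ z ℤ.+ w ℤ.- y ≡ x ℤ.- y ℤ.+ z ℤ.+ w
    swap = ℤSolver.solve-∀

  factorise : ∀ n → ℤ.+ (n * n + 8) ℤ.- ℤ.+ (6 * n) ≡ (ℤ.+ n ℤ.- ℤ.+ 2) ℤ.* (ℤ.+ n ℤ.- ℤ.+ 4)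
  factorise n = trans (cong₂ ℤ._-_ (trans (ℤP.pos-+ (n * n) 8) (cong (ℤ._+ ℤ.+ 8) (ℤP.pos-* n n))) (ℤP.pos-* 6 n))
                      (quadratic (ℤ.+ n))
    where
    quadratic : ∀ (x : ℤ) → x ℤ.* x ℤ.+ ℤ.+ 8 ℤ.- ℤ.+ 6 ℤ.* x ≡ (x ℤ.- ℤ.+ 2) ℤ.* (x ℤ.- ℤ.+ 4)
    quadratic = ℤSolver.solve-∀

  -- Betweenness as a sum over diagonals

  module PairRatios (m : ℕ) where

    open TargetV₀ m
    open Walks n
    open Rotation n
    open Geodesics n

    viaRatio : ℕ → ℕ → ℚ
    viaRatio a b = frac (ifEq (Eᵛ (a + b)) (Eᵛ a + Eᵛ b) (Nᵛ a * Nᵛ b)) (Nᵛ (a + b))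

    1≤N : ∀ s → 1 ≤ N s
    1≤N (u i) = minCount-pos (arcᵘ (toℕ i)) (arcᵘ (n ∸ toℕ i)) 1 1 ≤-refl ≤-refl
    1≤N (v i) = minCount-pos (arcᵛ (toℕ i)) (arcᵛ (n ∸ toℕ i)) _ _ (1≤arcGeodᵛ (toℕ i)) (1≤arcGeodᵛ (n ∸ toℕ i))

    module Pair (i j : Fin n) (1≤a : 1 ≤ toℕ i) (a<b : toℕ i < toℕ j) where
      a b r : ℕ
      a = toℕ i
      b = toℕ j
      r = n ∸ b

      b<n : b < n
      b<n = toℕ<n j
      r<n : r < n
      r<n = ∸-monoʳ-< {n} {b} {0} (≤-trans 1≤a (<⇒≤ a<b)) (<⇒≤ b<n)
      a+r<n : a + r < n
      a+r<n = subst (a + r <_) (m+[n∸m]≡n (<⇒≤ b<n)) (+-monoˡ-< r a<b)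

      rotate-vj : rotate r (v j) ≡ v₀ n
      rotate-vj = cong v (toℕ-injective (begin
        toℕ (shift n r j) ≡⟨ toℕ-shift r j ⟩
        (b + r) % n       ≡⟨ cong (_% n) (m+[n∸m]≡n (<⇒≤ b<n)) ⟩
        n % n             ≡⟨ n%n≡0 n ⟩
        0                 ∎))
        where open ≡-Reasoning
      toℕ-rotate-i : toℕ (shift n r i) ≡ a + r
      toℕ-rotate-i = trans (toℕ-shift r i) (m<n⇒m%n≡m a+r<n)
      toℕ-rotate-v₀ : toℕ (shift n r Fin.zero) ≡ r
      toℕ-rotate-v₀ = trans (toℕ-shift r Fin.zero) (m<n⇒m%n≡m r<n)

      walkCount-to-vj : ∀ k s → walkCount k s (v j) ≡ walkCount k (rotate r s) (v₀ n)
      walkCount-to-vj k s = trans (sym (walkCount-rotate r k s (v j) (m∸n≤m n b))) (cong (walkCount k (rotate r s)) rotate-vj)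

      d : ℕ
      d = E (rotate r (v i))

      d<2n : d < 0 + (n + n)
      d<2n = begin-strict
        d                         ≤⟨ m⊓n≤m (arcᵛ (toℕ (shift n r i))) _ ⟩
        arcᵛ (toℕ (shift n r i))  ≤⟨ arcᵛ≤3+ _ ⟩
        3 + toℕ (shift n r i)     <⟨ +-monoʳ-< 3 (toℕ<n (shift n r i)) ⟩
        3 + n                     ≤⟨ +-monoˡ-≤ n (≤-trans (≤-lit {3} {12}) (m≤m+n 12 m)) ⟩
        n + n                     ∎
        where open ≤-Reasoning

      geodesics-vi-vj : geodesics n (v i) (v j) ≡ walksTo n d (v i) (v j)
      geodesics-vi-vj = searchGeo-finds (n + n) 0 d (v i) (v j) z≤n d<2n
        (λ k k<d → trans (walkCount-to-vj k (v i)) (walkCount-short k _ k<d))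
        (subst (0 <_) (sym (trans (walkCount-to-vj d (v i)) (walkCount-exact d _ refl))) (1≤N (rotate r (v i))))

      σ-vi-vj : σ n (v i) (v j) ≡ N (rotate r (v i))
      σ-vi-vj = begin
        length (geodesics n (v i) (v j))     ≡⟨ cong length geodesics-vi-vj ⟩
        length (walksTo n d (v i) (v j))     ≡⟨ length-walksTo d (v i) (v j) ⟩
        walkCount d (v i) (v j)              ≡⟨ walkCount-to-vj d (v i) ⟩
        walkCount d (rotate r (v i)) (v₀ n)  ≡⟨ walkCount-exact d _ refl ⟩
        N (rotate r (v i))                   ∎
        where open ≡-Reasoning

      D M : ℕ
      D = E (rotate r (v₀ n))
      M = N (rotate r (v₀ n))

      vj≢v₀ : v j ≢ v₀ n
      vj≢v₀ e = <-irrefl (sym (cong toℕ (v-injective e))) (≤-trans 1≤a (<⇒≤ a<b))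

      1≤D : 1 ≤ D
      1≤D = ≤∧≢⇒< z≤n (λ 0≡D → <-irrefl (begin
        0                               ≡⟨ sym (cong toℕ (v-injective (E≡0⇒v₀ _ (sym 0≡D)))) ⟩
        toℕ (shift n r Fin.zero)        ≡⟨ toℕ-rotate-v₀ ⟩
        r                               ∎) (m<n⇒0<n∸m b<n))
        where open ≡-Reasoning

      open Through (v j) vj≢v₀ D M 1≤D
        (λ k k<D → trans (walkCount-to-vj k (v₀ n)) (walkCount-short k _ k<D))
        (trans (walkCount-to-vj D (v₀ n)) (walkCount-exact D _ refl))

      d≤E+D : d ≤ E (v i) + D
      d≤E+D with d ≤? E (v i) + D
      ... | yes d≤ = d≤
      ... | no d≰ = ⊥-elim (<-irrefl refl (<-≤-trans 0<via (≤-trans (count-∧-≤ _ _ (walks n K (v i))) (≤-reflexive no-walk))))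
        where
        K : ℕ
        K = E (v i) + D
        no-walk : walkCount K (v i) (v j) ≡ 0
        no-walk = trans (walkCount-to-vj K (v i)) (walkCount-short K _ (≰⇒> d≰))
        0<via : 0 < walkCountVia K (v i) (v j) (v₀ n)
        0<via = subst (0 <_) (sym (trans (walkCountVia-t K (v i) ≤-refl) (ifEq-yes {K} _ refl))) (*-mono-≤ (1≤N (v i)) (1≤N (rotate r (v₀ n))))

      σvia-vi-vj : σvia n (v i) (v j) (v₀ n) ≡ ifEq d (E (v i) + D) (N (v i) * M)
      σvia-vi-vj = begin
        length (filter (v₀ n ∈?_) (geodesics n (v i) (v j)))  ≡⟨ cong (λ L → length (filter (v₀ n ∈?_) L)) geodesics-vi-vj ⟩
        length (filter (v₀ n ∈?_) (walksTo n d (v i) (v j)))  ≡⟨ length-walksTo-via d (v i) (v j) (v₀ n) ⟩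
        walkCountVia d (v i) (v j) (v₀ n)                     ≡⟨ walkCountVia-t d (v i) d≤E+D ⟩
        ifEq d (E (v i) + D) (N (v i) * M)                    ∎
        where open ≡-Reasoning

      ratio : frac (σvia n (v i) (v j) (v₀ n)) (σ n (v i) (v j)) ≡ viaRatio a r
      ratio = cong₂ frac
        (trans σvia-vi-vj (cong₂ (λ x y → ifEq x (Eᵛ a + Eᵛ y) (Nᵛ a * Nᵛ y)) (cong Eᵛ toℕ-rotate-i) toℕ-rotate-v₀))
        (trans σ-vi-vj (cong Nᵛ toℕ-rotate-i))

  module BetweennessAsSum (m : ℕ) where

    open TargetV₀ m using (n)
    open PairRatios m

    -- B is defined through a pattern-matching lambda, so the pair summand is abstracted as h.
    module _ (h : Vertex n × Vertex n → ℚ) (h≡ : ∀ s t → h (s , t) ≡ frac (σvia n s t (v₀ n)) (σ n s t)) where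

      ∑-row : ∀ k (g : Fin k → Fin n) lo (x : Fin n) → (∀ i → toℕ (g i) ≡ lo + toℕ i) → 1 ≤ toℕ x → toℕ x < lo
            → ∑ℚ (map v (tabulate g)) (λ y → h (v x , y)) ≡ ∑ℚ (interval lo k) (λ b → viaRatio (toℕ x) (n ∸ b))
      ∑-row zero    g lo x g≡ 1≤x x<lo = refl
      ∑-row (suc k) g lo x g≡ 1≤x x<lo = cong₂ ℚ._+_ head
        (∑-row k (g ∘ Fin.suc) (suc lo) x (λ i → trans (g≡ (Fin.suc i)) (+-suc lo (toℕ i))) 1≤x (m≤n⇒m≤1+n x<lo))
        where
        g0≡lo : toℕ (g Fin.zero) ≡ lo
        g0≡lo = trans (g≡ Fin.zero) (+-identityʳ lo)
        head : h (v x , v (g Fin.zero)) ≡ viaRatio (toℕ x) (n ∸ lo)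
        head = trans (h≡ (v x) (v (g Fin.zero)))
                     (trans (Pair.ratio x (g Fin.zero) 1≤x (subst (toℕ x <_) (sym g0≡lo) x<lo))
                            (cong (λ z → viaRatio (toℕ x) (n ∸ z)) g0≡lo))

      ∑-pairs-inner : ∀ k (g : Fin k → Fin n) lo → 1 ≤ lo → (∀ i → toℕ (g i) ≡ lo + toℕ i)
                    → ∑ℚ (pairs (map v (tabulate g))) h ≡ ∑ℚ (pairs (interval lo k)) (λ p → viaRatio (proj₁ p) (n ∸ proj₂ p))
      ∑-pairs-inner zero    g lo 1≤lo g≡ = refl
      ∑-pairs-inner (suc k) g lo 1≤lo g≡ = begin
        ∑ℚ (pairs (map v (tabulate g))) h
          ≡⟨ ℚSum.∑-pairs-∷ (v (g Fin.zero)) (map v (tabulate (g ∘ Fin.suc))) h ⟩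
        ∑ℚ (map v (tabulate (g ∘ Fin.suc))) (λ y → h (v (g Fin.zero) , y)) ℚ.+ ∑ℚ (pairs (map v (tabulate (g ∘ Fin.suc)))) h
          ≡⟨ cong₂ ℚ._+_ (∑-row k (g ∘ Fin.suc) (suc lo) (g Fin.zero) g≡′ (subst (1 ≤_) (sym g0≡lo) 1≤lo)
                                (subst (_< suc lo) (sym g0≡lo) ≤-refl))
                         (∑-pairs-inner k (g ∘ Fin.suc) (suc lo) (m≤n⇒m≤1+n 1≤lo) g≡′) ⟩
        ∑ℚ (interval (suc lo) k) (λ b → viaRatio (toℕ (g Fin.zero)) (n ∸ b)) ℚ.+ rest
          ≡⟨ cong (λ z → ∑ℚ (interval (suc lo) k) (λ b → viaRatio z (n ∸ b)) ℚ.+ rest) g0≡lo ⟩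
        ∑ℚ (interval (suc lo) k) (λ b → viaRatio lo (n ∸ b)) ℚ.+ rest
          ≡⟨ sym (ℚSum.∑-pairs-∷ lo (interval (suc lo) k) _) ⟩
        ∑ℚ (pairs (interval lo (suc k))) (λ p → viaRatio (proj₁ p) (n ∸ proj₂ p)) ∎
        where
        open ≡-Reasoning
        rest : ℚ
        rest = ∑ℚ (pairs (interval (suc lo) k)) (λ p → viaRatio (proj₁ p) (n ∸ proj₂ p))
        g0≡lo : toℕ (g Fin.zero) ≡ lo
        g0≡lo = trans (g≡ Fin.zero) (+-identityʳ lo)
        g≡′ : ∀ i → toℕ (g (Fin.suc i)) ≡ suc lo + toℕ i
        g≡′ i = trans (g≡ (Fin.suc i)) (+-suc lo (toℕ i))

      ∑-pairs-inner∖v₀ : ∑ℚ (pairs (filter (λ y → ¬? (y ≟V v₀ n)) (inner n))) h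
                       ≡ ∑ℚ (pairs (interval 1 (11 + m))) (λ p → viaRatio (proj₁ p) (n ∸ proj₂ p))
      ∑-pairs-inner∖v₀ = trans (cong (λ L → ∑ℚ (pairs L) h) inner∖v₀) (∑-pairs-inner (11 + m) Fin.suc 1 ≤-refl (λ _ → refl))
        where
        inner∖v₀ : filter (λ y → ¬? (y ≟V v₀ n)) (inner n) ≡ map v (tabulate (λ (i : Fin (11 + m)) → Fin.suc i))
        inner∖v₀ = filter-all (λ y → ¬? (y ≟V v₀ n)) (AllP.map⁺ (AllP.tabulate⁺ {f = Fin.suc} (λ i ())))

    B≡∑diagonals : B n (v₀ n) (inner n) ≡ ∑ℚ (interval 2 (10 + m)) (ℚSum.diagonal viaRatio)
    B≡∑diagonals = begin
      B n (v₀ n) (inner n)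
        ≡⟨ ∑-pairs-inner∖v₀ _ (λ _ _ → refl) ⟩
      ∑ℚ (pairs (interval 1 (11 + m))) (λ p → viaRatio (proj₁ p) (n ∸ proj₂ p))
        ≡⟨ ℚSum.∑-pairs-interval n 1 (11 + m) viaRatio refl ⟩
      ∑ℚ (interval 1 (11 + m)) (λ a → ∑ℚ (interval 1 (11 + m ∸ a)) (viaRatio a))
        ≡⟨ ℚSum.∑-triangle-by-diagonals (11 + m) viaRatio ⟩
      ∑ℚ (interval 2 (10 + m)) (ℚSum.diagonal viaRatio) ∎
      where open ≡-Reasoning

  module ViaCounts (m : ℕ) where

    open TargetV₀ m

    module Route (a b : ℕ) (1≤a : 1 ≤ a) (1≤b : 1 ≤ b) (s<n : a + b < n) where

      s P P′ Q Q′ S S′ L : ℕ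
      s  = a + b
      P  = arcᵛ a
      P′ = arcᵛ (n ∸ a)
      Q  = arcᵛ b
      Q′ = arcᵛ (n ∸ b)
      S  = arcᵛ s
      S′ = arcᵛ (n ∸ s)
      L  = Eᵛ a + Eᵛ b

      b≤n∸a : b ≤ n ∸ a
      b≤n∸a = subst (_≤ n ∸ a) (m+n∸m≡n a b) (∸-monoˡ-≤ a (<⇒≤ s<n))
      a≤n∸b : a ≤ n ∸ b
      a≤n∸b = subst (_≤ n ∸ b) (m+n∸n≡m a b) (∸-monoˡ-≤ b (<⇒≤ s<n))
      n∸s+b : (n ∸ s) + b ≡ n ∸ a
      n∸s+b = trans (cong (_+ b) (sym (∸-+-assoc n a b))) (m∸n+n≡m b≤n∸a)
      n∸s+a : (n ∸ s) + a ≡ n ∸ b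
      n∸s+a = trans (cong (λ z → (n ∸ z) + a) (+-comm a b)) (trans (cong (_+ a) (sym (∸-+-assoc n b a))) (m∸n+n≡m a≤n∸b))

      -- a route v_s → v_b → v₀ that uses a long arc (P′ or Q′) is longer than the arc n ∸ s to v₀
      far₂ : suc S′ ≤ P′ + Q
      far₂ = subst (λ z → suc S′ ≤ arcᵛ z + Q) n∸s+b (arcᵛ<arcᵛ-+-+arcᵛ (n ∸ s) b 1≤b)
      far₃ : suc S′ ≤ P + Q′
      far₃ = subst (suc S′ ≤_) (+-comm Q′ P) (subst (λ z → suc S′ ≤ arcᵛ z + P) n∸s+a (arcᵛ<arcᵛ-+-+arcᵛ (n ∸ s) a 1≤a))
      far₄ : suc S′ ≤ P′ + Q′
      far₄ = double-≤-cancel (begin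
        suc S′ + suc S′          ≡⟨ +-suc (suc S′) S′ ⟩
        2 + (S′ + S′)            ≤⟨ +-monoʳ-≤ 2 (arcᵛ-double≤5+ (n ∸ s)) ⟩
        2 + ((n ∸ s) + 5)        ≡⟨ cong (2 +_) (+-comm (n ∸ s) 5) ⟩
        7 + (n ∸ s)              ≤⟨ +-monoˡ-≤ (n ∸ s) (≤-trans (≤-lit {7} {12}) (m≤m+n 12 m)) ⟩
        n + (n ∸ s)              ≡⟨ sym sum-complements ⟩
        (n ∸ a) + (n ∸ b)        ≤⟨ +-mono-≤ (k≤arcᵛ-double (n ∸ a)) (k≤arcᵛ-double (n ∸ b)) ⟩
        (P′ + P′) + (Q′ + Q′)    ≡⟨ interchange P′ P′ Q′ Q′ ⟩
        (P′ + Q′) + (P′ + Q′)    ∎)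
        where
        open ≤-Reasoning
        interchange : ∀ p q r t → (p + q) + (r + t) ≡ (p + r) + (q + t)
        interchange = solve-∀
        sum-complements : (n ∸ a) + (n ∸ b) ≡ n + (n ∸ s)
        sum-complements = begin-equality
          (n ∸ a) + (n ∸ b)        ≡⟨ cong ((n ∸ a) +_) (sym n∸s+a) ⟩
          (n ∸ a) + ((n ∸ s) + a)  ≡⟨ solve₃ (n ∸ a) (n ∸ s) a ⟩
          (n ∸ s) + ((n ∸ a) + a)  ≡⟨ cong ((n ∸ s) +_) (m∸n+n≡m (≤-trans (m≤m+n a b) (<⇒≤ s<n))) ⟩
          (n ∸ s) + n              ≡⟨ +-comm (n ∸ s) n ⟩
          n + (n ∸ s)              ∎
          where
          solve₃ : ∀ p q r → p + (q + r) ≡ q + (p + r)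
          solve₃ = solve-∀

      S+5ab≡P+Q : S + 5 * (parity a * parity b) ≡ P + Q
      S+5ab≡P+Q = arcᵛ-+ a b
      S≤P+Q : S ≤ P + Q
      S≤P+Q = subst (S ≤_) S+5ab≡P+Q (m≤m+n S _)

      both-short : S ≤ S′ → L ≡ S → (P < P′) × (Q < Q′)
      both-short S≤S′ L≡S = P<P′ , Q<Q′
        where
        P<P′ : P < P′
        P<P′ with P <? P′
        ... | yes p = p
        ... | no ¬p = ⊥-elim (<-irrefl (sym L≡S) (≤-trans (s≤s S≤S′)
                        (subst (λ z → suc S′ ≤ z + Eᵛ b) (sym (m≥n⇒m⊓n≡n (≮⇒≥ ¬p))) (via-P′ (⊓-sel Q Q′)))))
          where
          via-P′ : (Q ⊓ Q′ ≡ Q) ⊎ (Q ⊓ Q′ ≡ Q′) → suc S′ ≤ P′ + (Q ⊓ Q′)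
          via-P′ (inj₁ q) rewrite q = far₂
          via-P′ (inj₂ q) rewrite q = far₄
        Q<Q′ : Q < Q′
        Q<Q′ with Q <? Q′
        ... | yes p = p
        ... | no ¬p = ⊥-elim (<-irrefl (sym L≡S) (≤-trans (s≤s S≤S′)
                        (subst (λ z → suc S′ ≤ Eᵛ a + z) (sym (m≥n⇒m⊓n≡n (≮⇒≥ ¬p))) (via-Q′ (⊓-sel P P′)))))
          where
          via-Q′ : (P ⊓ P′ ≡ P) ⊎ (P ⊓ P′ ≡ P′) → suc S′ ≤ (P ⊓ P′) + Q′
          via-Q′ (inj₁ q) rewrite q = far₃
          via-Q′ (inj₂ q) rewrite q = far₄

      not-both-odd : S ≤ S′ → parity a * parity b ≡ 0 → parity a + parity b ≤ 1
                   → ifEq (Eᵛ s) L (Nᵛ a * Nᵛ b) ≡ ifLE S S′ (splitGeod a b)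
      not-both-odd S≤S′ ab≡0 a+b≤1 = begin
        ifEq (Eᵛ s) L (Nᵛ a * Nᵛ b)   ≡⟨ ifEq-yes _ (trans (m≤n⇒m⊓n≡m S≤S′) (sym L≡S)) ⟩
        Nᵛ a * Nᵛ b                    ≡⟨ cong₂ _*_ (shorter-arc (proj₁ short)) (shorter-arc (proj₂ short)) ⟩
        arcGeodᵛ a * arcGeodᵛ b        ≡⟨ sym (trans (ifLE-yes _ S≤S′) (ifLE-yes _ a+b≤1)) ⟩
        ifLE S S′ (splitGeod a b)      ∎
        where
        open ≡-Reasoning
        S≡P+Q : S ≡ P + Q
        S≡P+Q = trans (sym (+-identityʳ S)) (trans (cong (λ z → S + 5 * z) (sym ab≡0)) S+5ab≡P+Q)
        L≡S : L ≡ S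
        L≡S = ≤-antisym (subst (L ≤_) (sym S≡P+Q) (+-mono-≤ (m⊓n≤m P P′) (m⊓n≤m Q Q′)))
                (≤-+-⊓ S P P′ Q Q′ (≤-reflexive S≡P+Q) (via far₂) (via far₃) (via far₄))
          where
          via : ∀ {X} → suc S′ ≤ X → S ≤ X
          via far = ≤-trans S≤S′ (<⇒≤ far)
        short : (P < P′) × (Q < Q′)
        short = both-short S≤S′ L≡S
        shorter-arc : ∀ {k} → arcᵛ k < arcᵛ (n ∸ k) → Nᵛ k ≡ arcGeodᵛ k
        shorter-arc {k} lt = trans (cong₂ _+_ (ifLE-yes _ (<⇒≤ lt)) (ifLE-no _ (<⇒≱ lt))) (+-identityʳ (arcGeodᵛ k))

      viaCount≡splitGeod : ifEq (Eᵛ (a + b)) (Eᵛ a + Eᵛ b) (Nᵛ a * Nᵛ b) ≡ ifLE (arcᵛ (a + b)) (arcᵛ (n ∸ (a + b))) (splitGeod a b)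
      viaCount≡splitGeod with S ≤? S′
      ... | no S≰S′ = trans (ifEq-no _ (λ e → <-irrefl (trans (sym (m≥n⇒m⊓n≡n (<⇒≤ (≰⇒> S≰S′)))) e)
                                            (<-+-⊓ S′ P P′ Q Q′ (<-≤-trans (≰⇒> S≰S′) S≤P+Q) far₂ far₃ far₄)))
                            (sym (ifLE-no _ S≰S′))
      ... | yes S≤S′ with parity-cases a | parity-cases b
      ...   | inj₂ oa | inj₂ ob = trans (ifEq-no _ (λ e → <-irrefl (trans (sym (m≤n⇒m⊓n≡m S≤S′)) e)
                                    (<-+-⊓ S P P′ Q Q′ S<P+Q (via far₂) (via far₃) (via far₄))))
                                  (sym (trans (cong (λ z → ifLE S S′ (ifLE z 1 (arcGeodᵛ a * arcGeodᵛ b))) (cong₂ _+_ oa ob))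
                                              (ifLE-0 S S′)))
        where
        via : ∀ {X} → suc S′ ≤ X → suc S ≤ X
        via far = <-≤-trans (s≤s S≤S′) far
        S<P+Q : S < P + Q
        S<P+Q = subst (S <_) (trans (cong (λ z → S + 5 * z) (sym (cong₂ _*_ oa ob))) S+5ab≡P+Q)
                        (subst (_≤ S + 5) (+-comm S 1) (+-monoʳ-≤ S (s≤s z≤n)))
      ...   | inj₁ oa | _       = not-both-odd S≤S′ (cong (_* parity b) oa) (subst (λ z → z + parity b ≤ 1) (sym oa) (parity≤1 b))
      ...   | inj₂ oa | inj₁ ob = not-both-odd S≤S′ (cong₂ _*_ oa ob) (subst (_≤ 1) (sym (cong₂ _+_ oa ob)) ≤-refl)

    open Route public using (viaCount≡splitGeod)

  module DiagonalValues (m : ℕ) where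

    open TargetV₀ m
    open PairRatios m using (viaRatio)
    open ViaCounts m
    open BetweennessAsSum m using (B≡∑diagonals)

    ρ : ℕ → ℚ
    ρ s = frac (ifLE (arcᵛ s) (arcᵛ (n ∸ s)) (⌊ s ∸ 1 /2⌋ * arcGeodᵛ s)) (Nᵛ s)

    1≤Nᵛ : ∀ s → 1 ≤ Nᵛ s
    1≤Nᵛ s = minCount-pos (arcᵛ s) (arcᵛ (n ∸ s)) _ _ (1≤arcGeodᵛ s) (1≤arcGeodᵛ (n ∸ s))

    diagonal-viaRatio : ∀ s → 2 ≤ s → s < n → ℚSum.diagonal viaRatio s ≡ ρ s
    diagonal-viaRatio s 2≤s s<n = begin
      ℚSum.diagonal viaRatio s
        ≡⟨ ℚSum.∑-congᴵ 1 (s ∸ 1) term ⟩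
      ∑ℚ (interval 1 (s ∸ 1)) (λ a → frac (ifLE (arcᵛ s) (arcᵛ (n ∸ s)) (splitGeod a (s ∸ a))) (Nᵛ s))
        ≡⟨ ∑-frac (interval 1 (s ∸ 1)) _ (1≤Nᵛ s) ⟩
      frac (∑ℕ (interval 1 (s ∸ 1)) (λ a → ifLE (arcᵛ s) (arcᵛ (n ∸ s)) (splitGeod a (s ∸ a)))) (Nᵛ s)
        ≡⟨ cong (λ z → frac z (Nᵛ s)) (ifLE-∑ (interval 1 (s ∸ 1)) (arcᵛ s) (arcᵛ (n ∸ s)) (λ a → splitGeod a (s ∸ a))) ⟩
      frac (ifLE (arcᵛ s) (arcᵛ (n ∸ s)) (ℕSum.diagonal splitGeod s)) (Nᵛ s)
        ≡⟨ cong (λ z → frac (ifLE (arcᵛ s) (arcᵛ (n ∸ s)) z) (Nᵛ s)) (diagonal-splitGeod s) ⟩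
      ρ s ∎
      where
      open ≡-Reasoning
      1≤s : 1 ≤ s
      1≤s = ≤-trans (s≤s z≤n) 2≤s
      term : ∀ a → 1 ≤ a → a < 1 + (s ∸ 1)
           → viaRatio a (s ∸ a) ≡ frac (ifLE (arcᵛ s) (arcᵛ (n ∸ s)) (splitGeod a (s ∸ a))) (Nᵛ s)
      term a 1≤a a<s = trans (cong₂ frac (viaCount≡splitGeod a (s ∸ a) 1≤a 1≤s∸a (subst (_< n) (sym a+[s∸a]≡s) s<n)) (cong Nᵛ a+[s∸a]≡s))
                             (cong (λ z → frac (ifLE (arcᵛ z) (arcᵛ (n ∸ z)) (splitGeod a (s ∸ a))) (Nᵛ s)) a+[s∸a]≡s)
        where
        a<s′ : a < s
        a<s′ = subst (a <_) (m+[n∸m]≡n 1≤s) a<s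
        a+[s∸a]≡s : a + (s ∸ a) ≡ s
        a+[s∸a]≡s = m+[n∸m]≡n (<⇒≤ a<s′)
        1≤s∸a : 1 ≤ s ∸ a
        1≤s∸a = m<n⇒0<n∸m a<s′

    B≡∑ρ : B n (v₀ n) (inner n) ≡ ∑ℚ (interval 2 (10 + m)) ρ
    B≡∑ρ = trans B≡∑diagonals (ℚSum.∑-congᴵ 2 (10 + m) (λ s 2≤s s<12+m → diagonal-viaRatio s 2≤s s<12+m))

    ρ-shorter : ∀ s → arcᵛ s < arcᵛ (n ∸ s) → ρ s ≡ frac ⌊ s ∸ 1 /2⌋ 1
    ρ-shorter s lt = begin
      ρ s                                                       ≡⟨ cong₂ frac (ifLE-yes _ (<⇒≤ lt)) Nᵛ≡ ⟩
      frac (⌊ s ∸ 1 /2⌋ * arcGeodᵛ s) (arcGeodᵛ s)              ≡⟨ frac-*-cancel ⌊ s ∸ 1 /2⌋ (1≤arcGeodᵛ s) ⟩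
      frac ⌊ s ∸ 1 /2⌋ 1                                        ∎
      where
      open ≡-Reasoning
      Nᵛ≡ : Nᵛ s ≡ arcGeodᵛ s
      Nᵛ≡ = trans (cong₂ _+_ (ifLE-yes _ (<⇒≤ lt)) (ifLE-no _ (<⇒≱ lt))) (+-identityʳ (arcGeodᵛ s))

    ρ-longer : ∀ s → arcᵛ (n ∸ s) < arcᵛ s → ρ s ≡ 0ℚ
    ρ-longer s gt = trans (cong (λ z → frac z (Nᵛ s)) (ifLE-no _ (<⇒≱ gt))) (frac-0 (1≤Nᵛ s))

    ρ-tie : ∀ s → arcᵛ s ≡ arcᵛ (n ∸ s) → ρ s ≡ frac (⌊ s ∸ 1 /2⌋ * arcGeodᵛ s) (arcGeodᵛ s + arcGeodᵛ (n ∸ s))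
    ρ-tie s eq = cong₂ frac (ifLE-yes _ (≤-reflexive eq))
                            (cong₂ _+_ (ifLE-yes _ (≤-reflexive eq)) (ifLE-yes _ (≤-reflexive (sym eq))))

    shorter-if-small : ∀ s → s + s + 5 < n → arcᵛ s < arcᵛ (n ∸ s)
    shorter-if-small s lt = double-<-cancel (begin-strict
      arcᵛ s + arcᵛ s                    ≤⟨ arcᵛ-double≤5+ s ⟩
      s + 5                              <⟨ s+5<n∸s ⟩
      n ∸ s                              ≤⟨ k≤arcᵛ-double (n ∸ s) ⟩
      arcᵛ (n ∸ s) + arcᵛ (n ∸ s)        ∎)
      where
      open ≤-Reasoning
      s+5<n∸s : s + 5 < n ∸ s
      s+5<n∸s = subst (_< n ∸ s) (m+n∸m≡n s (s + 5)) (∸-monoˡ-< (subst (_< n) (+-assoc s s 5) lt) (m≤m+n s (s + 5)))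

    longer-if-large : ∀ s → s ≤ n → n + 5 < s + s → arcᵛ (n ∸ s) < arcᵛ s
    longer-if-large s s≤n lt = double-<-cancel (begin-strict
      arcᵛ (n ∸ s) + arcᵛ (n ∸ s)        ≤⟨ arcᵛ-double≤5+ (n ∸ s) ⟩
      (n ∸ s) + 5                        <⟨ n∸s+5<s ⟩
      s                                  ≤⟨ k≤arcᵛ-double s ⟩
      arcᵛ s + arcᵛ s                    ∎)
      where
      open ≤-Reasoning
      n∸s+5<s : (n ∸ s) + 5 < s
      n∸s+5<s = +-cancelˡ-< s _ _ (subst (_< s + s) (sym (trans (sym (+-assoc s (n ∸ s) 5)) (cong (_+ 5) (m+[n∸m]≡n s≤n)))) lt)

    ∑-ρ-low : ∀ L → (1 + L) + (1 + L) + 5 < n → ∑ℚ (interval 2 L) ρ ≡ frac (∑ℕ (interval 2 L) (λ s → ⌊ s ∸ 1 /2⌋)) 1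
    ∑-ρ-low L bound = trans (ℚSum.∑-congᴵ 2 L (λ s _ s<2+L → ρ-shorter s (shorter-if-small s (≤-<-trans (small s<2+L) bound))))
                            (∑-frac (interval 2 L) (λ s → ⌊ s ∸ 1 /2⌋) ≤-refl)
      where
      small : ∀ {s} → s < 2 + L → s + s + 5 ≤ (1 + L) + (1 + L) + 5
      small s<2+L = +-monoˡ-≤ 5 (+-mono-≤ (≤-pred s<2+L) (≤-pred s<2+L))

    ∑-ρ-high : ∀ lo len → lo + len ≤ n → n + 5 < lo + lo → ∑ℚ (interval lo len) ρ ≡ 0ℚ
    ∑-ρ-high lo len lo+len≤n bound = trans (ℚSum.∑-congᴵ lo len large) (ℚSum.∑-ε (interval lo len))
      where
      large : ∀ s → lo ≤ s → s < lo + len → ρ s ≡ 0ℚ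
      large s lo≤s s<lo+len =
        ρ-longer s (longer-if-large s (<⇒≤ (<-≤-trans s<lo+len lo+len≤n)) (<-≤-trans bound (+-mono-≤ lo≤s lo≤s)))

  -- Residue classes of n modulo 4

  -- For n = K + 4r the diagonal s = c + twice r with c + c′ = K compares its arcs like c and c′,
  -- since arcᵛ (c + twice r) = arcᵛ c + r.
  module Residue (k r : ℕ) where

    K D m : ℕ
    K = 12 + k
    D = twice r
    m = k + (D + D)

    open TargetV₀ m using (n)
    open DiagonalValues m

    n∸[c+D] : ∀ c c′ → c + c′ ≡ K → n ∸ (c + D) ≡ c′ + D
    n∸[c+D] c c′ c+c′≡K = begin
      K + (D + D) ∸ (c + D)        ≡⟨ cong (λ z → z + (D + D) ∸ (c + D)) (sym c+c′≡K) ⟩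
      c + c′ + (D + D) ∸ (c + D)  ≡⟨ cong (_∸ (c + D)) (shuffle c c′ D) ⟩
      (c + D) + (c′ + D) ∸ (c + D) ≡⟨ m+n∸m≡n (c + D) (c′ + D) ⟩
      c′ + D                      ∎
      where
      open ≡-Reasoning
      shuffle : ∀ c c′ D → c + c′ + (D + D) ≡ (c + D) + (c′ + D)
      shuffle = solve-∀

    shiftedGeod : ℕ → ℕ
    shiftedGeod c = arcGeodᵛ c + parity c * r

    arcᵛ-complement : ∀ c c′ → c + c′ ≡ K → arcᵛ (n ∸ (c + D)) ≡ arcᵛ c′ + r
    arcᵛ-complement c c′ c+c′≡K = trans (cong arcᵛ (n∸[c+D] c c′ c+c′≡K)) (arcᵛ-+twice c′ r)

    ρ-window-< : ∀ c c′ → 1 ≤ c → c + c′ ≡ K → arcᵛ c < arcᵛ c′ → ρ (c + D) ≡ frac (⌊ c ∸ 1 /2⌋ + r) 1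
    ρ-window-< (suc c) c′ _ c+c′≡K lt = trans
      (ρ-shorter (suc c + D) (subst₂ _<_ (sym (arcᵛ-+twice (suc c) r)) (sym (arcᵛ-complement (suc c) c′ c+c′≡K)) (+-monoˡ-< r lt)))
      (cong (λ z → frac z 1) (⌊+twice/2⌋ c r))

    ρ-window-> : ∀ c c′ → c + c′ ≡ K → arcᵛ c′ < arcᵛ c → ρ (c + D) ≡ frac 0 1
    ρ-window-> c c′ c+c′≡K gt = trans
      (ρ-longer (c + D) (subst₂ _<_ (sym (arcᵛ-complement c c′ c+c′≡K)) (sym (arcᵛ-+twice c r)) (+-monoˡ-< r gt)))
      (sym (frac-0 ≤-refl))

    ρ-window-= : ∀ c c′ → 1 ≤ c → c + c′ ≡ K → arcᵛ c ≡ arcᵛ c′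
               → ρ (c + D) ≡ frac ((⌊ c ∸ 1 /2⌋ + r) * shiftedGeod c) (shiftedGeod c + shiftedGeod c′)
    ρ-window-= (suc c) c′ _ c+c′≡K eq = trans
      (ρ-tie (suc c + D) (trans (arcᵛ-+twice (suc c) r) (trans (cong (_+ r) eq) (sym (arcᵛ-complement (suc c) c′ c+c′≡K)))))
      (cong₂ frac (cong₂ _*_ (⌊+twice/2⌋ c r) (arcGeodᵛ-+twice (suc c) r))
                  (cong₂ _+_ (arcGeodᵛ-+twice (suc c) r) (trans (cong arcGeodᵛ (n∸[c+D] (suc c) c′ c+c′≡K)) (arcGeodᵛ-+twice c′ r))))

    B-by-window : ∀ l w → l + l + 7 < K → 2 + l + w ≤ K → K + 5 < (2 + l + w) + (2 + l + w)
      → B n (v₀ n) (inner n) ≡ frac (∑ℕ (interval 2 (l + D)) (λ s → ⌊ s ∸ 1 /2⌋)) 1 ℚ.+ ∑ℚ (interval (2 + l + D) w) ρ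
    B-by-window l w low fits high = begin
      B n (v₀ n) (inner n)
        ≡⟨ B≡∑ρ ⟩
      ∑ℚ (interval 2 (10 + m)) ρ
        ≡⟨ cong (λ L → ∑ℚ (interval 2 L) ρ) lengths ⟩
      ∑ℚ (interval 2 ((l + D) + (w + H))) ρ
        ≡⟨ cong (λ L → ∑ℚ L ρ) (interval-++ 2 (l + D) (w + H)) ⟩
      ∑ℚ (interval 2 (l + D) ++ interval (2 + l + D) (w + H)) ρ
        ≡⟨ ℚSum.∑-++ (interval 2 (l + D)) _ ρ ⟩
      ∑ℚ (interval 2 (l + D)) ρ ℚ.+ ∑ℚ (interval (2 + l + D) (w + H)) ρ
        ≡⟨ cong₂ ℚ._+_ (∑-ρ-low (l + D) low′) (cong (λ L → ∑ℚ L ρ) (interval-++ (2 + l + D) w H)) ⟩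
      frac (∑ℕ (interval 2 (l + D)) (λ s → ⌊ s ∸ 1 /2⌋)) 1 ℚ.+ ∑ℚ (interval (2 + l + D) w ++ interval (2 + l + D + w) H) ρ
        ≡⟨ cong (lowValue ℚ.+_) (trans (ℚSum.∑-++ (interval (2 + l + D) w) (interval (2 + l + D + w) H) ρ)
                                       (trans (cong (window ℚ.+_) (∑-ρ-high (2 + l + D + w) H (≤-reflexive top) high′))
                                              (ℚP.+-identityʳ window))) ⟩
      frac (∑ℕ (interval 2 (l + D)) (λ s → ⌊ s ∸ 1 /2⌋)) 1 ℚ.+ ∑ℚ (interval (2 + l + D) w) ρ ∎
      where
      open ≡-Reasoning
      lowValue window : ℚ
      lowValue = frac (∑ℕ (interval 2 (l + D)) (λ s → ⌊ s ∸ 1 /2⌋)) 1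
      window   = ∑ℚ (interval (2 + l + D) w) ρ
      X H : ℕ
      X = K ∸ (2 + l + w)
      H = X + D
      X+l+w≡10+k : X + l + w ≡ 10 + k
      X+l+w≡10+k = +-cancelˡ-≡ 2 _ _ (trans (rearrange X l w) (m∸n+n≡m fits))
        where
        rearrange : ∀ X l w → 2 + (X + l + w) ≡ X + (2 + l + w)
        rearrange = solve-∀
      lengths : 10 + m ≡ (l + D) + (w + H)
      lengths = trans (cong (_+ (D + D)) (sym X+l+w≡10+k)) (arith X l w D)
        where
        arith : ∀ X l w D → X + l + w + (D + D) ≡ (l + D) + (w + (X + D))
        arith = solve-∀
      top : 2 + l + D + w + H ≡ n
      top = trans (arith X l w D) (cong (λ z → 2 + (z + (D + D))) X+l+w≡10+k)
        where
        arith : ∀ X l w D → 2 + l + D + w + (X + D) ≡ 2 + (X + l + w + (D + D))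
        arith = solve-∀
      low′ : (1 + (l + D)) + (1 + (l + D)) + 5 < n
      low′ = subst (_< n) (sym (arith l D)) (+-monoˡ-< (D + D) low)
        where
        arith : ∀ l D → (1 + (l + D)) + (1 + (l + D)) + 5 ≡ (l + l + 7) + (D + D)
        arith = solve-∀
      high′ : n + 5 < (2 + l + D + w) + (2 + l + D + w)
      high′ = subst₂ _<_ (arith₁ K D) (arith₂ l w D) (+-monoˡ-< (D + D) high)
        where
        arith₁ : ∀ K D → K + 5 + (D + D) ≡ K + (D + D) + 5
        arith₁ = solve-∀
        arith₂ : ∀ l w D → (2 + l + w) + (2 + l + w) + (D + D) ≡ (2 + l + D + w) + (2 + l + D + w)
        arith₂ = solve-∀

  module n≡1[mod4] (r : ℕ) where

    open Residue 1 r
    open TargetV₀ m using (n)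
    open DiagonalValues m using (ρ)

    L I : ℕ
    L = suc r * suc r
    I = 1 + r + (2 + r + (3 + r + 0))

    window : ∑ℚ (interval (4 + D) 6) ρ ≡ frac I 1
    window = trans (ℚSum.∑-pointwise (interval (4 + D) 6) ρ
                     (ρ-window-< 4 9 ≤-lit refl ≤-lit ∷ ρ-window-> 5 8 refl ≤-lit ∷ ρ-window-< 6 7 ≤-lit refl ≤-lit
                      ∷ ρ-window-> 7 6 refl ≤-lit ∷ ρ-window-< 8 5 ≤-lit refl ≤-lit ∷ ρ-window-> 9 4 refl ≤-lit ∷ []))
                   (∑-frac (1 + r ∷ 0 ∷ 2 + r ∷ 0 ∷ 3 + r ∷ 0 ∷ []) (λ x → x) ≤-refl)

    B-value : B n (v₀ n) (inner n) ≡ (ℤ.+ (n * n) ℤ.- ℤ.+ (6 * n) ℤ.+ ℤ.+ 21) ℚ./ 16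
    B-value = begin
      B n (v₀ n) (inner n)
        ≡⟨ B-by-window 2 6 ≤-lit ≤-lit ≤-lit ⟩
      frac (∑ℕ (interval 2 (2 + D)) (λ s → ⌊ s ∸ 1 /2⌋)) 1 ℚ.+ ∑ℚ (interval (4 + D) 6) ρ
        ≡⟨ cong₂ (λ x y → frac x 1 ℚ.+ y) (∑-⌊∸1/2⌋ (suc r)) window ⟩
      frac L 1 ℚ.+ frac I 1
        ≡⟨ frac-+ L I ≤-refl ⟩
      frac (L + I) 1
        ≡⟨ frac≡/-sub (L + I) 0 (n * n + 21) (6 * n) 15 arith ⟩
      (ℤ.+ (n * n + 21) ℤ.- ℤ.+ (6 * n)) ℚ./ 16
        ≡⟨ cong (ℚ._/ 16) (reorder (n * n) (6 * n) 21) ⟩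
      (ℤ.+ (n * n) ℤ.- ℤ.+ (6 * n) ℤ.+ ℤ.+ 21) ℚ./ 16 ∎
      where
      open ≡-Reasoning
      poly : ∀ r → (suc r * suc r + (1 + r + (2 + r + (3 + r + 0)))) * 16 + 6 * (13 + ((r + r) + (r + r))) * 1
                 ≡ ((13 + ((r + r) + (r + r))) * (13 + ((r + r) + (r + r))) + 21) * 1
      poly = solve-∀
      arith : (L + I) * 16 + 6 * (13 + (D + D)) * 1 ≡ ((13 + (D + D)) * (13 + (D + D)) + 21) * 1
      arith rewrite twice≡+ r = poly r

  module n≡3[mod4] (r : ℕ) where

    open Residue 3 r
    open TargetV₀ m using (n)
    open DiagonalValues m using (ρ)

    L I Y E : ℕ
    L = suc r * suc r + suc r
    I = 2 + r + (3 + r + 1)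
    Y = (2 + r) * (3 + 1 * r)
    E = ℕ.pred ((3 + 1 * r) + (1 + 0 * r))

    window : ∑ℚ (interval (5 + D) 6) ρ ≡ frac Y ((3 + 1 * r) + (1 + 0 * r)) ℚ.+ frac I 1
    window = trans (ℚSum.∑-pointwise (interval (5 + D) 6) ρ
                     (ρ-window-= 5 10 ≤-lit refl refl ∷ ρ-window-< 6 9 ≤-lit refl ≤-lit ∷ ρ-window-> 7 8 refl ≤-lit
                      ∷ ρ-window-< 8 7 ≤-lit refl ≤-lit ∷ ρ-window-> 9 6 refl ≤-lit ∷ trans (ρ-window-= 10 5 ≤-lit refl refl) tie ∷ []))
                   (cong (frac Y ((3 + 1 * r) + (1 + 0 * r)) ℚ.+_) (∑-frac (2 + r ∷ 0 ∷ 3 + r ∷ 0 ∷ 1 ∷ []) (λ x → x) ≤-refl))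
      where
      tie : frac ((4 + r) * (1 + 0 * r)) ((1 + 0 * r) + (3 + 1 * r)) ≡ frac 1 1
      tie = frac-cross ((4 + r) * (1 + 0 * r)) 1 (s≤s z≤n) ≤-refl (arith r)
        where
        arith : ∀ r → (4 + r) * (1 + 0 * r) * 1 ≡ 1 * ((1 + 0 * r) + (3 + 1 * r))
        arith = solve-∀

    B-value : B n (v₀ n) (inner n) ≡ (ℤ.+ (n * n * n) ℤ.- ℤ.+ (5 * (n * n)) ℤ.+ ℤ.+ (3 * n) ℤ.+ ℤ.+ 137) ℚ./ (16 * suc n)
    B-value = begin
      B n (v₀ n) (inner n)
        ≡⟨ B-by-window 3 6 ≤-lit ≤-lit ≤-lit ⟩
      frac (∑ℕ (interval 2 (3 + D)) (λ s → ⌊ s ∸ 1 /2⌋)) 1 ℚ.+ ∑ℚ (interval (5 + D) 6) ρ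
        ≡⟨ cong₂ (λ x y → frac x 1 ℚ.+ y) (∑-⌊∸1/2⌋-odd (suc r)) window ⟩
      frac L 1 ℚ.+ (frac Y ((3 + 1 * r) + (1 + 0 * r)) ℚ.+ frac I 1)
        ≡⟨ frac-int+frac+int L Y E I ⟩
      frac ((L + I) * ((3 + 1 * r) + (1 + 0 * r)) + Y) ((3 + 1 * r) + (1 + 0 * r))
        ≡⟨ frac≡/-sub ((L + I) * ((3 + 1 * r) + (1 + 0 * r)) + Y) E (n * n * n + 3 * n + 137) (5 * (n * n)) (n + 15 * suc n) arith ⟩
      (ℤ.+ (n * n * n + 3 * n + 137) ℤ.- ℤ.+ (5 * (n * n))) ℚ./ (16 * suc n)
        ≡⟨ cong (ℚ._/ (16 * suc n)) (reorder₄ (n * n * n) (5 * (n * n)) (3 * n) 137) ⟩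
      (ℤ.+ (n * n * n) ℤ.- ℤ.+ (5 * (n * n)) ℤ.+ ℤ.+ (3 * n) ℤ.+ ℤ.+ 137) ℚ./ (16 * suc n) ∎
      where
      open ≡-Reasoning
      poly : ∀ r → ((suc r * suc r + suc r + (2 + r + (3 + r + 1))) * ((3 + 1 * r) + (1 + 0 * r)) + (2 + r) * (3 + 1 * r))
                     * (16 * suc (15 + ((r + r) + (r + r))))
                   + 5 * ((15 + ((r + r) + (r + r))) * (15 + ((r + r) + (r + r)))) * ((3 + 1 * r) + (1 + 0 * r))
                 ≡ ((15 + ((r + r) + (r + r))) * (15 + ((r + r) + (r + r))) * (15 + ((r + r) + (r + r)))
                     + 3 * (15 + ((r + r) + (r + r))) + 137) * ((3 + 1 * r) + (1 + 0 * r))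
      poly = solve-∀
      arith : ((L + I) * ((3 + 1 * r) + (1 + 0 * r)) + Y) * (16 * suc (15 + (D + D)))
                + 5 * ((15 + (D + D)) * (15 + (D + D))) * ((3 + 1 * r) + (1 + 0 * r))
            ≡ ((15 + (D + D)) * (15 + (D + D)) * (15 + (D + D)) + 3 * (15 + (D + D)) + 137) * ((3 + 1 * r) + (1 + 0 * r))
      arith rewrite twice≡+ r = poly r

  module n≡0[mod4] (j : ℕ) where

    open Residue 0 j
    open TargetV₀ m using (n)
    open DiagonalValues m using (ρ)

    L I Y : ℕ
    L = suc j * suc j
    I = 1 + j + (2 + j + 0)
    Y = (2 + j) * (1 + 0 * j)

    window : ∑ℚ (interval (4 + D) 5) ρ ≡ frac Y ((1 + 0 * j) + (1 + 0 * j)) ℚ.+ frac I 1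
    window = trans (ℚSum.∑-pointwise (interval (4 + D) 5) ρ
                     (ρ-window-< 4 8 ≤-lit refl ≤-lit ∷ ρ-window-< 5 7 ≤-lit refl ≤-lit ∷ ρ-window-= 6 6 ≤-lit refl refl
                      ∷ ρ-window-> 7 5 refl ≤-lit ∷ ρ-window-> 8 4 refl ≤-lit ∷ []))
                   (trans (ℚ-+-pull (frac (1 + j) 1) (frac (2 + j) 1) (frac Y ((1 + 0 * j) + (1 + 0 * j))) (frac 0 1 ℚ.+ (frac 0 1 ℚ.+ 0ℚ)))
                          (cong (frac Y ((1 + 0 * j) + (1 + 0 * j)) ℚ.+_) (∑-frac (1 + j ∷ 2 + j ∷ 0 ∷ 0 ∷ []) (λ x → x) ≤-refl)))

    B-value : B n (v₀ n) (inner n) ≡ ((ℤ.+ n ℤ.- ℤ.+ 2) ℤ.* (ℤ.+ n ℤ.- ℤ.+ 4)) ℚ./ 16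
    B-value = begin
      B n (v₀ n) (inner n)
        ≡⟨ B-by-window 2 5 ≤-lit ≤-lit ≤-lit ⟩
      frac (∑ℕ (interval 2 (2 + D)) (λ s → ⌊ s ∸ 1 /2⌋)) 1 ℚ.+ ∑ℚ (interval (4 + D) 5) ρ
        ≡⟨ cong₂ (λ x y → frac x 1 ℚ.+ y) (∑-⌊∸1/2⌋ (suc j)) window ⟩
      frac L 1 ℚ.+ (frac Y ((1 + 0 * j) + (1 + 0 * j)) ℚ.+ frac I 1)
        ≡⟨ frac-int+frac+int L Y 1 I ⟩
      frac ((L + I) * 2 + Y) 2
        ≡⟨ frac≡/-sub ((L + I) * 2 + Y) 1 (n * n + 8) (6 * n) 15 arith ⟩
      (ℤ.+ (n * n + 8) ℤ.- ℤ.+ (6 * n)) ℚ./ 16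
        ≡⟨ cong (ℚ._/ 16) (factorise n) ⟩
      ((ℤ.+ n ℤ.- ℤ.+ 2) ℤ.* (ℤ.+ n ℤ.- ℤ.+ 4)) ℚ./ 16 ∎
      where
      open ≡-Reasoning
      poly : ∀ j → ((suc j * suc j + (1 + j + (2 + j + 0))) * 2 + (2 + j) * (1 + 0 * j)) * 16
                   + 6 * (12 + ((j + j) + (j + j))) * 2
                 ≡ ((12 + ((j + j) + (j + j))) * (12 + ((j + j) + (j + j))) + 8) * 2
      poly = solve-∀
      arith : ((L + I) * 2 + Y) * 16 + 6 * (12 + (D + D)) * 2 ≡ ((12 + (D + D)) * (12 + (D + D)) + 8) * 2
      arith rewrite twice≡+ j = poly j

  module n≡2[mod4] (j : ℕ) where

    open Residue 2 j
    open TargetV₀ m using (n)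
    open DiagonalValues m using (ρ)

    L I Y E : ℕ
    L = suc j * suc j + suc j
    I = 2 + j + (2 + j + 0)
    Y = (3 + j) * (4 + 1 * j)
    E = ℕ.pred ((4 + 1 * j) + (4 + 1 * j))

    window : ∑ℚ (interval (5 + D) 5) ρ ≡ frac Y ((4 + 1 * j) + (4 + 1 * j)) ℚ.+ frac I 1
    window = trans (ℚSum.∑-pointwise (interval (5 + D) 5) ρ
                     (ρ-window-< 5 9 ≤-lit refl ≤-lit ∷ ρ-window-< 6 8 ≤-lit refl ≤-lit ∷ ρ-window-= 7 7 ≤-lit refl refl
                      ∷ ρ-window-> 8 6 refl ≤-lit ∷ ρ-window-> 9 5 refl ≤-lit ∷ []))
                   (trans (ℚ-+-pull (frac (2 + j) 1) (frac (2 + j) 1) (frac Y ((4 + 1 * j) + (4 + 1 * j))) (frac 0 1 ℚ.+ (frac 0 1 ℚ.+ 0ℚ)))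
                          (cong (frac Y ((4 + 1 * j) + (4 + 1 * j)) ℚ.+_) (∑-frac (2 + j ∷ 2 + j ∷ 0 ∷ 0 ∷ []) (λ x → x) ≤-refl)))

    B-value : B n (v₀ n) (inner n) ≡ ((ℤ.+ n ℤ.- ℤ.+ 2) ℤ.* (ℤ.+ n ℤ.- ℤ.+ 4)) ℚ./ 16
    B-value = begin
      B n (v₀ n) (inner n)
        ≡⟨ B-by-window 3 5 ≤-lit ≤-lit ≤-lit ⟩
      frac (∑ℕ (interval 2 (3 + D)) (λ s → ⌊ s ∸ 1 /2⌋)) 1 ℚ.+ ∑ℚ (interval (5 + D) 5) ρ
        ≡⟨ cong₂ (λ x y → frac x 1 ℚ.+ y) (∑-⌊∸1/2⌋-odd (suc j)) window ⟩
      frac L 1 ℚ.+ (frac Y ((4 + 1 * j) + (4 + 1 * j)) ℚ.+ frac I 1)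
        ≡⟨ frac-int+frac+int L Y E I ⟩
      frac ((L + I) * ((4 + 1 * j) + (4 + 1 * j)) + Y) ((4 + 1 * j) + (4 + 1 * j))
        ≡⟨ frac≡/-sub ((L + I) * ((4 + 1 * j) + (4 + 1 * j)) + Y) E (n * n + 8) (6 * n) 15 arith ⟩
      (ℤ.+ (n * n + 8) ℤ.- ℤ.+ (6 * n)) ℚ./ 16
        ≡⟨ cong (ℚ._/ 16) (factorise n) ⟩
      ((ℤ.+ n ℤ.- ℤ.+ 2) ℤ.* (ℤ.+ n ℤ.- ℤ.+ 4)) ℚ./ 16 ∎
      where
      open ≡-Reasoning
      poly : ∀ j → ((suc j * suc j + suc j + (2 + j + (2 + j + 0))) * ((4 + 1 * j) + (4 + 1 * j)) + (3 + j) * (4 + 1 * j)) * 16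
                   + 6 * (14 + ((j + j) + (j + j))) * ((4 + 1 * j) + (4 + 1 * j))
                 ≡ ((14 + ((j + j) + (j + j))) * (14 + ((j + j) + (j + j))) + 8) * ((4 + 1 * j) + (4 + 1 * j))
      poly = solve-∀
      arith : ((L + I) * ((4 + 1 * j) + (4 + 1 * j)) + Y) * 16 + 6 * (14 + (D + D)) * ((4 + 1 * j) + (4 + 1 * j))
            ≡ ((14 + (D + D)) * (14 + (D + D)) + 8) * ((4 + 1 * j) + (4 + 1 * j))
      arith rewrite twice≡+ j = poly j

  mod-form : ∀ n d c k .{{_ : NonZero d}} → n % d ≡ c → c + k * d ≤ n → ∃ λ q → n ≡ c + (k + q) * d
  mod-form n d c k n%d≡c lower = n / d ∸ k , (begin
    n                          ≡⟨ m≡m%n+[m/n]*n n d ⟩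
    n % d + n / d * d          ≡⟨ cong₂ (λ x y → x + y * d) n%d≡c (sym (m+[n∸m]≡n k≤n/d)) ⟩
    c + (k + (n / d ∸ k)) * d  ∎)
    where
    open ≡-Reasoning
    k≤n/d : k ≤ n / d
    k≤n/d = *-cancelʳ-≤ k (n / d) d (+-cancelˡ-≤ c _ _ (subst (c + k * d ≤_) (trans (m≡m%n+[m/n]*n n d) (cong (_+ n / d * d) n%d≡c)) lower))

  n≡13+4r : ∀ n → 13 ≤ n → n % 4 ≡ 1 → ∃ λ r → n ≡ 13 + (twice r + twice r)
  n≡13+4r n 13≤n n%4≡1 with mod-form n 4 1 3 n%4≡1 13≤n
  ... | r , n≡ = r , trans n≡ (trans (arith r) (cong (λ d → 13 + (d + d)) (sym (twice≡+ r))))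
    where
    arith : ∀ r → 1 + (3 + r) * 4 ≡ 13 + ((r + r) + (r + r))
    arith = solve-∀

  n≡15+4r : ∀ n → 15 ≤ n → n % 4 ≡ 3 → ∃ λ r → n ≡ 15 + (twice r + twice r)
  n≡15+4r n 15≤n n%4≡3 with mod-form n 4 3 3 n%4≡3 15≤n
  ... | r , n≡ = r , trans n≡ (trans (arith r) (cong (λ d → 15 + (d + d)) (sym (twice≡+ r))))
    where
    arith : ∀ r → 3 + (3 + r) * 4 ≡ 15 + ((r + r) + (r + r))
    arith = solve-∀

  n≡12+4j⊎n≡14+4j : ∀ n → 12 ≤ n → n % 2 ≡ 0
                  → ∃ λ j → n ≡ 12 + (twice j + twice j) ⊎ n ≡ 14 + (twice j + twice j)
  n≡12+4j⊎n≡14+4j n 12≤n n%2≡0 with mod-form n 2 0 6 n%2≡0 12≤n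
  ... | p , n≡ with twice-or-1+twice p
  ...   | j , inj₁ refl = j , inj₁ (trans n≡ (trans (arith j) (cong (λ d → 12 + (d + d)) (sym (twice≡+ j)))))
    where
    arith : ∀ j → 0 + (6 + twice j) * 2 ≡ 12 + ((j + j) + (j + j))
    arith j rewrite twice≡+ j = poly j
      where
      poly : ∀ j → 0 + (6 + (j + j)) * 2 ≡ 12 + ((j + j) + (j + j))
      poly = solve-∀
  ...   | j , inj₂ refl = j , inj₂ (trans n≡ (trans (arith j) (cong (λ d → 14 + (d + d)) (sym (twice≡+ j)))))
    where
    arith : ∀ j → 0 + (6 + suc (twice j)) * 2 ≡ 14 + ((j + j) + (j + j))
    arith j rewrite twice≡+ j = poly j
      where
      poly : ∀ j → 0 + (6 + suc (j + j)) * 2 ≡ 14 + ((j + j) + (j + j))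
      poly = solve-∀

  B-value-1[mod4] : ∀ n .{{_ : NonZero n}} → 13 ≤ n → n % 4 ≡ 1
                  → B n (v₀ n) (inner n) ≡ (ℤ.+ (n * n) ℤ.- ℤ.+ (6 * n) ℤ.+ ℤ.+ 21) ℚ./ 16
  B-value-1[mod4] n 13≤n n%4≡1 with n≡13+4r n 13≤n n%4≡1
  ... | r , refl = n≡1[mod4].B-value r

  B-value-3[mod4] : ∀ n .{{_ : NonZero n}} → 15 ≤ n → n % 4 ≡ 3
                  → B n (v₀ n) (inner n) ≡ (ℤ.+ (n * n * n) ℤ.- ℤ.+ (5 * (n * n)) ℤ.+ ℤ.+ (3 * n) ℤ.+ ℤ.+ 137) ℚ./ (16 * suc n)
  B-value-3[mod4] n 15≤n n%4≡3 with n≡15+4r n 15≤n n%4≡3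
  ... | r , refl = n≡3[mod4].B-value r

  B-value-even : ∀ n .{{_ : NonZero n}} → 12 ≤ n → n % 2 ≡ 0
               → B n (v₀ n) (inner n) ≡ ((ℤ.+ n ℤ.- ℤ.+ 2) ℤ.* (ℤ.+ n ℤ.- ℤ.+ 4)) ℚ./ 16
  B-value-even n 12≤n n%2≡0 with n≡12+4j⊎n≡14+4j n 12≤n n%2≡0
  ... | j , inj₁ refl = n≡0[mod4].B-value j
  ... | j , inj₂ refl = n≡2[mod4].B-value j

open import Defs
open import Data.Nat using (ℕ; suc; _≤_; _*_; NonZero)
open import Data.Nat.DivMod using (_%_)
open import Data.Integer using (+_; _-_; _+_)
open import Data.Rational using (ℚ; _/_)
open import Data.Product using (_×_; _,_)
open import Relation.Binary.PropositionalEquality using (_≡_)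

mainTheorem19 : (n : ℕ) → .{{_ : NonZero n}}
    → ((13 ≤ n) → n % 4 ≡ 1
         → B n (v₀ n) (inner n) ≡ (+ (n * n) - + (6 * n) + + 21) / 16)
    × ((15 ≤ n) → n % 4 ≡ 3
         → B n (v₀ n) (inner n)
           ≡ (+ (n * n * n) - + (5 * (n * n)) + + (3 * n) + + 137) / (16 * suc n))
    × ((12 ≤ n) → n % 2 ≡ 0
         → B n (v₀ n) (inner n) ≡ (((+ n - + 2) Data.Integer.* (+ n - + 4)) / 16))
mainTheorem19 n = Betweenness.B-value-1[mod4] n , Betweenness.B-value-3[mod4] n , Betweenness.B-value-even n
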